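{- Let $A$ be an integral domain, $A \subseteq K \subseteq \overline{K}$ with $K,\overline{K}$ fields and $\overline{K}$ algebraically closed. Let $m\geq 1$, $f_1,\ldots,f_m\in A[x]$, and define $F_1 := f_1$, $F_2 := f_2+y_3f_3+\cdots+y_mf_m$ (with $F_2:=0$ if $m=1$) as polynomials in $x$ with coefficients in $A[y_3,\ldots,y_m]$. Suppose $G := \gcd_K(f_1, \ldots, f_m)$ has degree $\delta \geq 1$, and let $b_1, \ldots, b_d$ be the distinct roots of $G$ in $\overline{K}$, with multiplicities $\mu_1,\ldots,\mu_d$. Then $$S_\delta(F_1, F_2) = \ell \prod_{i=1}^d (x-b_i)^{\mu_i},$$ where $\ell$ is the leading coefficient of $S_\delta(F_1, F_2)$ as a polynomial in $x$.
   Context: $\gcd_K$ is the greatest common divisor in $K[x]$ (defined up to a unit, with $\gcd(h,0)=h$ and $\gcd(f_1)=f_1$). Subresultants: let $R$ be an integral domain and $f = a_px^p + \cdots + a_0$, $g = b_qx^q + \cdots + b_0$ in $R[x]$ with $a_p,b_q\neq 0$. The Sylvester matrix $S_{f,g}$ is the $(p+q)\times(p+q)$ matrix whose first $q$ rows are $(a_p,\ldots,a_0,0,\ldots,0)$ successively shifted one place to the right and whose last $p$ rows are $(b_q,\ldots,b_0,0,\ldots,0)$ successively shifted one place to the right. For $0\leq i\leq\min\{p,q\}$ the $i$-th subresultant is $S_i(f,g) := \sum_{j=0}^{i} s_{ij}(f,g)x^j$, where $s_{ij}(f,g)$ is the determinant of the submatrix of $S_{f,g}$ formed by rows $1,\ldots,q-i$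 and $q+1,\ldots,q+p-i$ and columns $1,2,\ldots,p+q-2i-1$ and $p+q-i-j$. When $p=q\neq 0$ one sets $S_q(f,g)=g$ (and $s_{qj}$ its coefficients); when $p=q=0$, $S_0(f,g)=1$. If $g=0$ and $f\neq 0$, $S_i(f,g):=S_i(f,f)$ for $0\leq i\leq\deg f$, and symmetrically if $f=0$. Here subresultants of $F_1,F_2$ are taken over $R=A[y_3,\ldots,y_m]$. -}

module Defs where

open import Level using (Level; _⊔_)
open import Algebra.Bundles using (CommutativeRing)
open import Algebra.Bundles.Raw using (RawRing)
open import Data.Nat using (ℕ; zero; suc; _∸_; _≤?_; _<_; _≤_) renaming (_+_ to _+ℕ_)
open import Data.Nat.Properties using (_≟_)
open import Data.Fin using (Fin; zero; suc; toℕ; punchIn)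
open import Data.List using (List; []; _∷_; map; upTo)
open import Data.Product using (Σ; _×_; _,_; ∃)
open import Data.Sum using (_⊎_)
open import Data.Unit.Polymorphic using (⊤)
open import Data.Bool using (Bool; true; false; if_then_else_; _∧_)
open import Relation.Nullary using (¬_; does)
open import Relation.Binary.PropositionalEquality using (_≡_)

isEven : ℕ → Bool
isEven zero = true
isEven (suc zero) = false
isEven (suc (suc n)) = isEven n

module _ {c ℓ} (R : CommutativeRing c ℓ) where
  open CommutativeRing R

  IsIntegralDomain : Set (c ⊔ ℓ)
  IsIntegralDomain = (¬ (1# ≈ 0#)) × (∀ x y → (x * y) ≈ 0# → (x ≈ 0#) ⊎ (y ≈ 0#))

  IsField : Set (c ⊔ ℓ)
  IsField = (¬ (1# ≈ 0#)) × (∀ x → ¬ (x ≈ 0#) → ∃ λ y → (x * y) ≈ 1#)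

-- Univariate polynomials over a raw ring, as coefficient lists
-- (constant term first); equality is coefficientwise up to trailing zeros.

module PolyOps {c ℓ} (R : RawRing c ℓ) where
  open RawRing R

  Poly : Set c
  Poly = List Carrier

  infix 4 _≈P_
  _≈P_ : Poly → Poly → Set ℓ
  []      ≈P []      = ⊤
  []      ≈P (b ∷ q) = (b ≈ 0#) × ([] ≈P q)
  (a ∷ p) ≈P []      = (a ≈ 0#) × (p ≈P [])
  (a ∷ p) ≈P (b ∷ q) = (a ≈ b) × (p ≈P q)

  infixl 6 _+P_
  _+P_ : Poly → Poly → Poly
  []      +P q       = q
  (a ∷ p) +P []      = a ∷ p
  (a ∷ p) +P (b ∷ q) = (a + b) ∷ (p +P q)

  -P_ : Poly → Poly
  -P_ = map -_

  scale : Carrier → Poly → Poly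
  scale a = map (a *_)

  infixl 7 _*P_
  _*P_ : Poly → Poly → Poly
  []      *P q = []
  (a ∷ p) *P q = scale a q +P (0# ∷ (p *P q))

  constP : Carrier → Poly
  constP a = a ∷ []

  0P 1P X : Poly
  0P = []
  1P = 1# ∷ []
  X  = 0# ∷ 1# ∷ []

  infixr 8 _^P_
  _^P_ : Poly → ℕ → Poly
  p ^P zero  = 1P
  p ^P suc n = p *P (p ^P n)

  X-_ : Carrier → Poly
  X- b = (- b) ∷ 1# ∷ []

  coeff : Poly → ℕ → Carrier
  coeff []      k       = 0#
  coeff (a ∷ p) zero    = a
  coeff (a ∷ p) (suc k) = coeff p k

  eval : Poly → Carrier → Carrier
  eval []      z = 0#
  eval (a ∷ p) z = a + (z * eval p z)

  HasDegree : Poly → ℕ → Set ℓ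
  HasDegree p n = (¬ (coeff p n ≈ 0#)) × (∀ k → n < k → coeff p k ≈ 0#)

  IsZeroP : Poly → Set ℓ
  IsZeroP p = p ≈P 0P

  -- leading coefficient (of the zero polynomial: 0)
  IsLeadingCoeff : Carrier → Poly → Set ℓ
  IsLeadingCoeff l p = (Σ ℕ λ n → HasDegree p n × (l ≈ coeff p n)) ⊎ (IsZeroP p × (l ≈ 0#))

  infix 4 _∣P_
  _∣P_ : Poly → Poly → Set (c ⊔ ℓ)
  g ∣P p = ∃ λ h → (g *P h) ≈P p

  IsGcdOf : ∀ {m} → Poly → (Fin m → Poly) → Set (c ⊔ ℓ)
  IsGcdOf G fs = (∀ i → G ∣P fs i) × (∀ H → (∀ i → H ∣P fs i) → H ∣P G)

  IsRoot : Poly → Carrier → Set ℓ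
  IsRoot p z = eval p z ≈ 0#

  HasMultiplicity : Poly → Carrier → ℕ → Set (c ⊔ ℓ)
  HasMultiplicity p b μ = ((X- b) ^P μ ∣P p) × (¬ ((X- b) ^P suc μ ∣P p))

  RootsWithMultiplicities : Poly → (d : ℕ) → (Fin d → Carrier) → (Fin d → ℕ) → Set (c ⊔ ℓ)
  RootsWithMultiplicities p d b μ =
    (∀ i j → b i ≈ b j → i ≡ j) ×
    (∀ i → IsRoot p (b i)) ×
    (∀ z → IsRoot p z → ∃ λ i → z ≈ b i) ×
    (∀ i → HasMultiplicity p (b i) (μ i))

  sumFin : (n : ℕ) → (Fin n → Carrier) → Carrier
  sumFin zero    v = 0#
  sumFin (suc n) v = v zero + sumFin n (λ i → v (suc i))

  sumFinP : (n : ℕ) → (Fin n → Poly) → Poly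
  sumFinP zero    v = 0P
  sumFinP (suc n) v = v zero +P sumFinP n (λ i → v (suc i))

  prodFinP : (n : ℕ) → (Fin n → Poly) → Poly
  prodFinP zero    v = 1P
  prodFinP (suc n) v = v zero *P prodFinP n (λ i → v (suc i))

  det : (n : ℕ) → (Fin n → Fin n → Carrier) → Carrier
  det zero    M = 1#
  det (suc n) M = sumFin (suc n) λ j →
    let t = M zero j * det n (λ r s → M (suc r) (punchIn j s))
    in if isEven (toℕ j) then t else - t

  -- Sylvester matrix entries (0-based row shift s, 0-based column c0):
  -- a row (a_p, …, a_0, 0, …) shifted s places to the right
  sylRow : ℕ → Poly → ℕ → ℕ → Carrier
  sylRow p f s c0 =
    if does (s ≤? c0) ∧ does (c0 ∸ s ≤? p) then coeff f (p ∸ (c0 ∸ s)) else 0#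

  -- s_{ij}(f,g) for deg f = p, deg g = q: determinant of the submatrix of
  -- S_{f,g} on rows 1..q-i, q+1..q+p-i and columns 1..p+q-2i-1, p+q-i-j.
  sresCoeff : (p q : ℕ) → Poly → Poly → (i j : ℕ) → Carrier
  sresCoeff p q f g i j = det n M
    where
    n : ℕ
    n = (p ∸ i) +ℕ (q ∸ i)
    col : Fin n → ℕ
    col u = if does (toℕ u ≟ n ∸ 1) then (p +ℕ q) ∸ i ∸ j ∸ 1 else toℕ u
    M : Fin n → Fin n → Carrier
    M t u = if does (suc (toℕ t) ≤? q ∸ i)
              then sylRow p f (toℕ t) (col u)
              else sylRow q g (toℕ t ∸ (q ∸ i)) (col u)

  -- i-th subresultant S_i(f,g) for deg f = p, deg g = q (both ≠ 0 as polynomials)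
  sres : (p q : ℕ) → Poly → Poly → ℕ → Poly
  sres p q f g i =
    if does (p ≟ q)
    then (if does (q ≟ 0) then 1P
          else if does (i ≟ q) then g
          else general)
    else general
    where
    general : Poly
    general = map (sresCoeff p q f g i) (upTo (suc i))

  IsSubres : Poly → Poly → ℕ → Poly → Set ℓ
  IsSubres f g i S =
    (Σ ℕ λ p → Σ ℕ λ q → HasDegree f p × HasDegree g q × i ≤ p × i ≤ q × (S ≈P sres p q f g i)) ⊎
    (Σ ℕ λ p → HasDegree f p × IsZeroP g × i ≤ p × (S ≈P sres p p f f i)) ⊎
    (Σ ℕ λ q → IsZeroP f × HasDegree g q × i ≤ q × (S ≈P sres q q g g i))

  IsAlgClosed : Set (c ⊔ ℓ)
  IsAlgClosed = ∀ p n → HasDegree p n → 1 ≤ n → ∃ λ z → IsRoot p z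

PolyRaw : ∀ {c ℓ} → RawRing c ℓ → RawRing c ℓ
PolyRaw R = record
  { Carrier = Poly ; _≈_ = _≈P_ ; _+_ = _+P_ ; _*_ = _*P_ ; -_ = -P_ ; 0# = 0P ; 1# = 1P }
  where open PolyOps R

-- R[y₁,…,y_n], as iterated polynomial rings
iterPoly : ∀ {c ℓ} → ℕ → RawRing c ℓ → RawRing c ℓ
iterPoly zero    R = R
iterPoly (suc n) R = PolyRaw (iterPoly n R)

module _ {c ℓ} (R : RawRing c ℓ) where
  open RawRing

  constI : (n : ℕ) → Carrier R → Carrier (iterPoly n R)
  constI zero    a = a
  constI (suc n) a = constI n a ∷ []

  var : (n : ℕ) → Fin n → Carrier (iterPoly n R)
  var (suc n) zero    = PolyOps.X (iterPoly n R)
  var (suc n) (suc j) = var n j ∷ []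

  liftX : (n : ℕ) → List (Carrier R) → List (Carrier (iterPoly n R))
  liftX n = map (constI n)

  -- F₁ = f₁ and F₂ = f₂ + y₃ f₃ + ⋯ + y_m f_m (F₂ = 0 if m = 1),
  -- in A[y₃,…,y_m][x]; the m-2 variables y₃..y_m are var (m ∸ 2) 0, 1, …
  F₁ : (m : ℕ) → (Fin m → List (Carrier R)) → List (Carrier (iterPoly (m ∸ 2) R))
  F₁ zero    f = []
  F₁ (suc n) f = liftX (suc n ∸ 2) (f zero)

  F₂ : (m : ℕ) → (Fin m → List (Carrier R)) → List (Carrier (iterPoly (m ∸ 2) R))
  F₂ zero          f = []
  F₂ (suc zero)    f = []
  F₂ (suc (suc k)) f =
    liftX k (f (suc zero)) +P
    sumFinP k (λ j → constP (var k j) *P liftX k (f (suc (suc j))))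
    where open PolyOps (iterPoly k R)

mapIter : ∀ {a ℓa b ℓb} {RA : RawRing a ℓa} {RB : RawRing b ℓb} (n : ℕ) →
          (RawRing.Carrier RA → RawRing.Carrier RB) →
          RawRing.Carrier (iterPoly n RA) → RawRing.Carrier (iterPoly n RB)
mapIter zero    φ x = φ x
mapIter (suc n) φ x = map (mapIter n φ) x

module Submission where

-- Over the algebraically closed field K̄ the gcd factors as
-- G = c ∏ (x - bᵢ)^{μᵢ}, c ≠ 0 its top coefficient (Factorisation).  Its image H in
-- K̄[y][x] divides every fᵢ, hence F₁ and the combination F₂ (GenericPolynomials).
-- A common divisor of two polynomials divides their subresultants
-- (SubresultantDivisibility): the coefficients of Sᵢ are minors of the Sylvester
-- matrix, and column operations turn Sᵢ into one determinant whose last column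
-- consists of the multiples x^e F₁, x^e F₂ (BorderedDeterminant).  Subresultants
-- commute with ring homomorphisms (SubresultantImage), so H divides the image of
-- S = S_δ(F₁, F₂).  As deg S ≤ δ = deg H and the top coefficient of H is
-- invertible, the image of S is w H for a constant w (LinearFactors), and comparing
-- the coefficients of x^δ gives w c = image of ℓ (Transport).

open import Defs
open import Level using (Level)
open import Algebra.Bundles using (CommutativeRing)
open import Algebra.Bundles.Raw using (RawRing)
open import Algebra.Morphism.Structures using (module RingMorphisms)
open import Data.Nat using (ℕ; _∸_; _≤_)
open import Data.Fin using (Fin)
open import Data.List using (List; map)
open import Data.List.Properties using (map-∘)
open import Data.Product using (Σ; proj₁; proj₂)
import Relation.Binary.PropositionalEquality as Eq

-- Coefficient lists over a commutative ring form a commutative ring.  Every law is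
-- proved coefficientwise, through the equivalent relation _≋_ below.
module PolynomialArithmetic where

  open import Algebra.Bundles using (CommutativeRing)
  open import Data.Nat using (zero; suc)
  open import Data.List using ([]; _∷_)
  open import Data.Product using (_,_)
  open import Data.Unit.Polymorphic using (tt)
  open import Relation.Binary.Bundles using (Setoid)
  open import Relation.Binary.PropositionalEquality using (_≡_) renaming (refl to ≡-refl)
  import Relation.Binary.Reasoning.Setoid

  module PolyLaws {c ℓ} (R : CommutativeRing c ℓ) where
    open CommutativeRing R public hiding (zero)
    open PolyOps rawRing public
    open import Relation.Binary.Reasoning.Setoid setoid public
    open import Algebra.Properties.CommutativeSemigroup +-commutativeSemigroup public using (interchange)
    open import Algebra.Properties.Ring ring public using (-‿distribˡ-*; -‿distribʳ-*; x+x≈x⇒x≈0; -0#≈0#)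

    -- equality of all coefficients; equivalent to _≈P_, but as a record it does not
    -- unfold by the shape of the lists, which keeps the algebraic laws simple to state
    infix 4 _≋_
    record _≋_ (p q : Poly) : Set ℓ where
      constructor mk
      field at : ∀ k → coeff p k ≈ coeff q k
    open _≋_ public

    coeffwise : ∀ p q → p ≈P q → ∀ k → coeff p k ≈ coeff q k
    coeffwise [] [] e k = refl
    coeffwise [] (b ∷ q) (b0 , e) zero = sym b0
    coeffwise [] (b ∷ q) (b0 , e) (suc k) = coeffwise [] q e k
    coeffwise (a ∷ p) [] (a0 , e) zero = a0
    coeffwise (a ∷ p) [] (a0 , e) (suc k) = coeffwise p [] e k
    coeffwise (a ∷ p) (b ∷ q) (ab , e) zero = ab
    coeffwise (a ∷ p) (b ∷ q) (ab , e) (suc k) = coeffwise p q e k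

    fromCoeffwise : ∀ p q → (∀ k → coeff p k ≈ coeff q k) → p ≈P q
    fromCoeffwise [] [] h = tt
    fromCoeffwise [] (b ∷ q) h = sym (h zero) , fromCoeffwise [] q (λ k → h (suc k))
    fromCoeffwise (a ∷ p) [] h = h zero , fromCoeffwise p [] (λ k → h (suc k))
    fromCoeffwise (a ∷ p) (b ∷ q) h = h zero , fromCoeffwise p q (λ k → h (suc k))

    ≋→≈P : ∀ {p q} → p ≋ q → p ≈P q
    ≋→≈P {p} {q} e = fromCoeffwise p q (at e)
    ≈P→≋ : ∀ {p q} → p ≈P q → p ≋ q
    ≈P→≋ {p} {q} e = mk (coeffwise p q e)

    ≋-refl : ∀ {p} → p ≋ p
    ≋-refl = mk λ k → refl
    ≋-sym : ∀ {p q} → p ≋ q → q ≋ p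
    ≋-sym e = mk λ k → sym (at e k)
    ≋-trans : ∀ {p q r} → p ≋ q → q ≋ r → p ≋ r
    ≋-trans e f = mk λ k → trans (at e k) (at f k)

    ≋-reflexive : ∀ {p q} → p ≡ q → p ≋ q
    ≋-reflexive ≡-refl = ≋-refl

    ≋-setoid : Setoid c ℓ
    ≋-setoid = record { Carrier = Poly ; _≈_ = _≋_ ; isEquivalence = record { refl = ≋-refl ; sym = ≋-sym ; trans = ≋-trans } }

    module PR = Relation.Binary.Reasoning.Setoid ≋-setoid

    cons-cong : ∀ {a a' p p'} → a ≈ a' → p ≋ p' → (a ∷ p) ≋ (a' ∷ p')
    cons-cong e f = mk λ { zero → e ; (suc k) → at f k }

    cons-[] : ∀ {a p} → a ≈ 0# → p ≋ [] → (a ∷ p) ≋ []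
    cons-[] e f = mk λ { zero → e ; (suc k) → at f k }

    tail-≋ : ∀ {a a' p p'} → (a ∷ p) ≋ (a' ∷ p') → p ≋ p'
    tail-≋ e = mk λ k → at e (suc k)

    tail-[] : ∀ {a p} → (a ∷ p) ≋ [] → p ≋ []
    tail-[] e = mk λ k → at e (suc k)

    coeff-+ : ∀ p q k → coeff (p +P q) k ≈ coeff p k + coeff q k
    coeff-+ [] q k = sym (+-identityˡ _)
    coeff-+ (a ∷ p) [] k = sym (+-identityʳ _)
    coeff-+ (a ∷ p) (b ∷ q) zero = refl
    coeff-+ (a ∷ p) (b ∷ q) (suc k) = coeff-+ p q k

    coeff-scale : ∀ a p k → coeff (scale a p) k ≈ a * coeff p k
    coeff-scale a [] k = sym (zeroʳ a)
    coeff-scale a (b ∷ p) zero = refl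
    coeff-scale a (b ∷ p) (suc k) = coeff-scale a p k

    coeff-neg : ∀ p k → coeff (-P p) k ≈ - coeff p k
    coeff-neg [] k = sym -0#≈0#
    coeff-neg (b ∷ p) zero = refl
    coeff-neg (b ∷ p) (suc k) = coeff-neg p k

    +P-cong : ∀ {p p' q q'} → p ≋ p' → q ≋ q' → (p +P q) ≋ (p' +P q')
    +P-cong {p} {p'} {q} {q'} e f = mk λ k → begin
      coeff (p +P q) k ≈⟨ coeff-+ p q k ⟩
      coeff p k + coeff q k ≈⟨ +-cong (at e k) (at f k) ⟩
      coeff p' k + coeff q' k ≈⟨ sym (coeff-+ p' q' k) ⟩
      coeff (p' +P q') k ∎

    scale-cong : ∀ {a a' p p'} → a ≈ a' → p ≋ p' → scale a p ≋ scale a' p'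
    scale-cong {a} {a'} {p} {p'} e f = mk λ k → begin
      coeff (scale a p) k ≈⟨ coeff-scale a p k ⟩
      a * coeff p k ≈⟨ *-cong e (at f k) ⟩
      a' * coeff p' k ≈⟨ sym (coeff-scale a' p' k) ⟩
      coeff (scale a' p') k ∎

    -P-cong : ∀ {p p'} → p ≋ p' → (-P p) ≋ (-P p')
    -P-cong {p} {p'} e = mk λ k → begin
      coeff (-P p) k ≈⟨ coeff-neg p k ⟩
      - coeff p k ≈⟨ -‿cong (at e k) ⟩
      - coeff p' k ≈⟨ sym (coeff-neg p' k) ⟩
      coeff (-P p') k ∎

    +P-comm : ∀ p q → (p +P q) ≋ (q +P p)
    +P-comm p q = mk λ k → trans (coeff-+ p q k) (trans (+-comm _ _) (sym (coeff-+ q p k)))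

    +P-assoc : ∀ p q r → ((p +P q) +P r) ≋ (p +P (q +P r))
    +P-assoc p q r = mk λ k → begin
      coeff ((p +P q) +P r) k ≈⟨ coeff-+ (p +P q) r k ⟩
      coeff (p +P q) k + coeff r k ≈⟨ +-congʳ (coeff-+ p q k) ⟩
      (coeff p k + coeff q k) + coeff r k ≈⟨ +-assoc _ _ _ ⟩
      coeff p k + (coeff q k + coeff r k) ≈⟨ +-congˡ (sym (coeff-+ q r k)) ⟩
      coeff p k + coeff (q +P r) k ≈⟨ sym (coeff-+ p (q +P r) k) ⟩
      coeff (p +P (q +P r)) k ∎

    +P-idˡ : ∀ p → ([] +P p) ≋ p
    +P-idˡ p = ≋-refl

    +P-idʳ : ∀ p → (p +P []) ≋ p
    +P-idʳ p = mk λ k → trans (coeff-+ p [] k) (+-identityʳ _)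

    -P-invˡ : ∀ p → ((-P p) +P p) ≋ []
    -P-invˡ p = mk λ k → begin
      coeff ((-P p) +P p) k ≈⟨ coeff-+ (-P p) p k ⟩
      coeff (-P p) k + coeff p k ≈⟨ +-congʳ (coeff-neg p k) ⟩
      - coeff p k + coeff p k ≈⟨ -‿inverseˡ _ ⟩
      0# ∎

    -P-invʳ : ∀ p → (p +P (-P p)) ≋ []
    -P-invʳ p = ≋-trans (+P-comm p (-P p)) (-P-invˡ p)

    scale-+ : ∀ a p q → scale a (p +P q) ≋ (scale a p +P scale a q)
    scale-+ a p q = mk λ k → begin
      coeff (scale a (p +P q)) k ≈⟨ coeff-scale a (p +P q) k ⟩
      a * coeff (p +P q) k ≈⟨ *-congˡ (coeff-+ p q k) ⟩
      a * (coeff p k + coeff q k) ≈⟨ distribˡ _ _ _ ⟩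
      a * coeff p k + a * coeff q k ≈⟨ sym (+-cong (coeff-scale a p k) (coeff-scale a q k)) ⟩
      coeff (scale a p) k + coeff (scale a q) k ≈⟨ sym (coeff-+ (scale a p) (scale a q) k) ⟩
      coeff (scale a p +P scale a q) k ∎

    scale-+ˡ : ∀ a b p → scale (a + b) p ≋ (scale a p +P scale b p)
    scale-+ˡ a b p = mk λ k → begin
      coeff (scale (a + b) p) k ≈⟨ coeff-scale (a + b) p k ⟩
      (a + b) * coeff p k ≈⟨ distribʳ _ _ _ ⟩
      a * coeff p k + b * coeff p k ≈⟨ sym (+-cong (coeff-scale a p k) (coeff-scale b p k)) ⟩
      coeff (scale a p) k + coeff (scale b p) k ≈⟨ sym (coeff-+ (scale a p) (scale b p) k) ⟩
      coeff (scale a p +P scale b p) k ∎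

    scale-scale : ∀ a b p → scale a (scale b p) ≋ scale (a * b) p
    scale-scale a b p = mk λ k → begin
      coeff (scale a (scale b p)) k ≈⟨ coeff-scale a (scale b p) k ⟩
      a * coeff (scale b p) k ≈⟨ *-congˡ (coeff-scale b p k) ⟩
      a * (b * coeff p k) ≈⟨ sym (*-assoc _ _ _) ⟩
      (a * b) * coeff p k ≈⟨ sym (coeff-scale (a * b) p k) ⟩
      coeff (scale (a * b) p) k ∎

    scale-0 : ∀ p → scale 0# p ≋ []
    scale-0 p = mk λ k → trans (coeff-scale 0# p k) (zeroˡ _)

    scale-1 : ∀ p → scale 1# p ≋ p
    scale-1 p = mk λ k → trans (coeff-scale 1# p k) (*-identityˡ _)

    swap4 : ∀ a b c d → ((a +P b) +P (c +P d)) ≋ ((a +P c) +P (b +P d))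
    swap4 a b c d = mk λ k → begin
      coeff ((a +P b) +P (c +P d)) k ≈⟨ coeff-+ (a +P b) (c +P d) k ⟩
      coeff (a +P b) k + coeff (c +P d) k ≈⟨ +-cong (coeff-+ a b k) (coeff-+ c d k) ⟩
      (coeff a k + coeff b k) + (coeff c k + coeff d k) ≈⟨ interchange (coeff a k) (coeff b k) (coeff c k) (coeff d k) ⟩
      (coeff a k + coeff c k) + (coeff b k + coeff d k) ≈⟨ sym (+-cong (coeff-+ a c k) (coeff-+ b d k)) ⟩
      coeff (a +P c) k + coeff (b +P d) k ≈⟨ sym (coeff-+ (a +P c) (b +P d) k) ⟩
      coeff ((a +P c) +P (b +P d)) k ∎

    cons0-+ : ∀ p q → (0# ∷ (p +P q)) ≋ ((0# ∷ p) +P (0# ∷ q))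
    cons0-+ p q = cons-cong (sym (+-identityˡ 0#)) ≋-refl

    *P-[]ʳ : ∀ p → (p *P []) ≋ []
    *P-[]ʳ [] = ≋-refl
    *P-[]ʳ (a ∷ p) = cons-[] refl (*P-[]ʳ p)

    *P-congʳ : ∀ p {q q'} → q ≋ q' → (p *P q) ≋ (p *P q')
    *P-congʳ [] e = ≋-refl
    *P-congʳ (a ∷ p) e = +P-cong (scale-cong refl e) (cons-cong refl (*P-congʳ p e))

    *P-zeroˡ : ∀ p q → p ≋ [] → (p *P q) ≋ []
    *P-zeroˡ [] q e = ≋-refl
    *P-zeroˡ (a ∷ p) q e =
      ≋-trans (+P-cong (≋-trans (scale-cong (at e zero) ≋-refl) (scale-0 q)) (cons-cong refl (*P-zeroˡ p q (tail-[] e)))) (cons-[] refl ≋-refl)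

    *P-congˡ : ∀ {p p'} q → p ≋ p' → (p *P q) ≋ (p' *P q)
    *P-congˡ {[]} {[]} q e = ≋-refl
    *P-congˡ {[]} {b ∷ p'} q e = ≋-sym (*P-zeroˡ (b ∷ p') q (≋-sym e))
    *P-congˡ {a ∷ p} {[]} q e = *P-zeroˡ (a ∷ p) q e
    *P-congˡ {a ∷ p} {b ∷ p'} q e = +P-cong (scale-cong (at e zero) ≋-refl) (cons-cong refl (*P-congˡ q (tail-≋ e)))

    *P-cong : ∀ {p p' q q'} → p ≋ p' → q ≋ q' → (p *P q) ≋ (p' *P q')
    *P-cong {p} {p'} {q} {q'} e f = ≋-trans (*P-congˡ q e) (*P-congʳ p' f)

    cons0-* : ∀ p q → ((0# ∷ p) *P q) ≋ (0# ∷ (p *P q))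
    cons0-* p q = +P-cong (scale-0 q) ≋-refl

    *P-distribˡ : ∀ p q r → (p *P (q +P r)) ≋ ((p *P q) +P (p *P r))
    *P-distribˡ [] q r = ≋-refl
    *P-distribˡ (a ∷ p) q r =
      ≋-trans (+P-cong (scale-+ a q r) (≋-trans (cons-cong refl (*P-distribˡ p q r)) (cons0-+ (p *P q) (p *P r))))
              (swap4 (scale a q) (scale a r) (0# ∷ (p *P q)) (0# ∷ (p *P r)))

    *P-distribʳ : ∀ p q r → ((p +P q) *P r) ≋ ((p *P r) +P (q *P r))
    *P-distribʳ [] q r = ≋-refl
    *P-distribʳ (a ∷ p) [] r = ≋-sym (+P-idʳ ((a ∷ p) *P r))
    *P-distribʳ (a ∷ p) (b ∷ q) r =
      ≋-trans (+P-cong (scale-+ˡ a b r) (≋-trans (cons-cong refl (*P-distribʳ p q r)) (cons0-+ (p *P r) (q *P r))))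
              (swap4 (scale a r) (scale b r) (0# ∷ (p *P r)) (0# ∷ (q *P r)))

    scale-*ˡ : ∀ a p q → ((scale a p) *P q) ≋ scale a (p *P q)
    scale-*ˡ a [] q = ≋-refl
    scale-*ˡ a (b ∷ p) q =
      ≋-trans (+P-cong (≋-sym (scale-scale a b q)) (cons-cong (sym (zeroʳ a)) (scale-*ˡ a p q)))
              (≋-sym (scale-+ a (scale b q) (0# ∷ (p *P q))))

    scale-comm : ∀ a b p → scale a (scale b p) ≋ scale b (scale a p)
    scale-comm a b p = ≋-trans (scale-scale a b p) (≋-trans (scale-cong (*-comm a b) ≋-refl) (≋-sym (scale-scale b a p)))

    scale-*ʳ : ∀ a p q → (p *P (scale a q)) ≋ scale a (p *P q)
    scale-*ʳ a [] q = ≋-refl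
    scale-*ʳ a (b ∷ p) q =
      ≋-trans (+P-cong (scale-comm b a q) (cons-cong (sym (zeroʳ a)) (scale-*ʳ a p q)))
              (≋-sym (scale-+ a (scale b q) (0# ∷ (p *P q))))

    -- multiplication by x·q + b, the mirror image of the defining clause of _*P_
    *P-consʳ : ∀ p b q → (p *P (b ∷ q)) ≋ (scale b p +P (0# ∷ (p *P q)))
    *P-consʳ [] b q = ≋-sym (cons-[] refl ≋-refl)
    *P-consʳ (a ∷ p) b q = cons-cong (+-cong (*-comm a b) refl) rest
      where
      rest : (scale a q +P (p *P (b ∷ q))) ≋ (scale b p +P (scale a q +P (0# ∷ (p *P q))))
      rest = ≋-trans (+P-cong (≋-refl {scale a q}) (*P-consʳ p b q))
             (≋-trans (≋-sym (+P-assoc (scale a q) (scale b p) (0# ∷ (p *P q))))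
             (≋-trans (+P-cong (+P-comm (scale a q) (scale b p)) (≋-refl {0# ∷ (p *P q)}))
                      (+P-assoc (scale b p) (scale a q) (0# ∷ (p *P q)))))

    *P-comm : ∀ p q → (p *P q) ≋ (q *P p)
    *P-comm [] q = ≋-sym (*P-[]ʳ q)
    *P-comm (a ∷ p) q = ≋-trans (+P-cong (≋-refl {scale a q}) (cons-cong refl (*P-comm p q))) (≋-sym (*P-consʳ q a p))

    *P-assoc : ∀ p q r → ((p *P q) *P r) ≋ (p *P (q *P r))
    *P-assoc [] q r = ≋-refl
    *P-assoc (a ∷ p) q r =
      ≋-trans (*P-distribʳ (scale a q) (0# ∷ (p *P q)) r)
              (+P-cong (scale-*ˡ a q r) (≋-trans (cons0-* (p *P q) r) (cons-cong refl (*P-assoc p q r))))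

    const-*P : ∀ a p → ((a ∷ []) *P p) ≋ scale a p
    const-*P a p = ≋-trans (+P-cong ≋-refl (cons-[] refl ≋-refl)) (+P-idʳ (scale a p))

    *P-idˡ : ∀ p → (1P *P p) ≋ p
    *P-idˡ p = ≋-trans (const-*P 1# p) (scale-1 p)

    *P-idʳ : ∀ p → (p *P 1P) ≋ p
    *P-idʳ p = ≋-trans (*P-comm p 1P) (*P-idˡ p)

-- R[x] and R[y₁,…,yₙ] as commutative rings, whose raw rings are exactly the ones
-- (PolyRaw, iterPoly) used in the statement.
module PolynomialRings where

  open PolynomialArithmetic
  open import Algebra.Bundles using (CommutativeRing)
  open import Algebra.Bundles.Raw using (RawRing)
  open import Algebra.Structures using (IsCommutativeRing)
  open import Data.Nat using (ℕ; zero; suc)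
  open import Data.List using ([])
  open import Data.Product using (_,_)

  module _ {c ℓ} (R : CommutativeRing c ℓ) where
    open PolyLaws R

    polyIsCommutativeRing : IsCommutativeRing _≈P_ _+P_ _*P_ -P_ [] 1P
    polyIsCommutativeRing = record
      { isRing = record
        { +-isAbelianGroup = record
          { isGroup = record
            { isMonoid = record
              { isSemigroup = record
                { isMagma = record
                  { isEquivalence = record
                    { refl = λ {p} → ≋→≈P (≋-refl {p})
                    ; sym = λ e → ≋→≈P (≋-sym (≈P→≋ e))
                    ; trans = λ e f → ≋→≈P (≋-trans (≈P→≋ e) (≈P→≋ f)) }
                  ; ∙-cong = λ e f → ≋→≈P (+P-cong (≈P→≋ e) (≈P→≋ f)) }
                ; assoc = λ p q r → ≋→≈P (+P-assoc p q r) }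
              ; identity = (λ p → ≋→≈P (+P-idˡ p)) , (λ p → ≋→≈P (+P-idʳ p)) }
            ; inverse = (λ p → ≋→≈P (-P-invˡ p)) , (λ p → ≋→≈P (-P-invʳ p))
            ; ⁻¹-cong = λ e → ≋→≈P (-P-cong (≈P→≋ e)) }
          ; comm = λ p q → ≋→≈P (+P-comm p q) }
        ; *-cong = λ e f → ≋→≈P (*P-cong (≈P→≋ e) (≈P→≋ f))
        ; *-assoc = λ p q r → ≋→≈P (*P-assoc p q r)
        ; *-identity = (λ p → ≋→≈P (*P-idˡ p)) , (λ p → ≋→≈P (*P-idʳ p))
        ; distrib = (λ p q r → ≋→≈P (*P-distribˡ p q r)) , (λ p q r → ≋→≈P (*P-distribʳ q r p)) }
      ; *-comm = λ p q → ≋→≈P (*P-comm p q) }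

  PolyCR : ∀ {c ℓ} → CommutativeRing c ℓ → CommutativeRing c ℓ
  PolyCR R = record { isCommutativeRing = polyIsCommutativeRing R }

  -- R[y₁,…,yₙ]; the structure is built separately (iterIs) so that the raw ring of
  -- iterCR n R is definitionally iterPoly n (rawRing R), even for a variable n
  iterCR : ∀ {c ℓ} → ℕ → CommutativeRing c ℓ → CommutativeRing c ℓ
  iterIs : ∀ {c ℓ} (n : ℕ) (R : CommutativeRing c ℓ) →
    let RR = iterPoly n (CommutativeRing.rawRing R) in
    IsCommutativeRing (RawRing._≈_ RR) (RawRing._+_ RR) (RawRing._*_ RR) (RawRing.-_ RR) (RawRing.0# RR) (RawRing.1# RR)

  iterCR n R = record { isCommutativeRing = iterIs n R }

  iterIs zero R = CommutativeRing.isCommutativeRing R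
  iterIs (suc n) R = polyIsCommutativeRing (iterCR n R)

module RingHomomorphisms where

  open PolynomialArithmetic
  open PolynomialRings
  open import Level using (_⊔_)
  open import Algebra.Bundles using (CommutativeRing)
  open import Algebra.Morphism.Structures using (module RingMorphisms)
  open import Data.Nat using (zero; suc)
  open import Data.List using ([]; _∷_; map)
  open import Function using (_∘_)

  module _ {a ℓa b ℓb} (R : CommutativeRing a ℓa) (S : CommutativeRing b ℓb) where
    private
      module R = CommutativeRing R
      module S = CommutativeRing S
    record IsHom (h : R.Carrier → S.Carrier) : Set (a ⊔ ℓa ⊔ ℓb) where
      field
        h-cong : ∀ {x y} → x R.≈ y → h x S.≈ h y
        h-+ : ∀ x y → h (x R.+ y) S.≈ (h x S.+ h y)
        h-* : ∀ x y → h (x R.* y) S.≈ (h x S.* h y)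
        h-neg : ∀ x → h (R.- x) S.≈ (S.- h x)
        h-0 : h R.0# S.≈ S.0#
        h-1 : h R.1# S.≈ S.1#

    fromRingHom : ∀ {h} → RingMorphisms.IsRingHomomorphism R.rawRing S.rawRing h → IsHom h
    fromRingHom {h} H = record
      { h-cong = ⟦⟧-cong ; h-+ = +-homo ; h-* = *-homo ; h-neg = -‿homo ; h-0 = 0#-homo ; h-1 = 1#-homo }
      where open RingMorphisms.IsRingHomomorphism H

  open IsHom public

  module _ {a ℓa b ℓb d ℓd} {R : CommutativeRing a ℓa} {S : CommutativeRing b ℓb} {T : CommutativeRing d ℓd} where
    private
      module T = CommutativeRing T
    compHom : ∀ {h g} → IsHom R S h → IsHom S T g → IsHom R T (g ∘ h)
    compHom H G = record
      { h-cong = λ e → h-cong G (h-cong H e)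
      ; h-+ = λ x y → T.trans (h-cong G (h-+ H x y)) (h-+ G _ _)
      ; h-* = λ x y → T.trans (h-cong G (h-* H x y)) (h-* G _ _)
      ; h-neg = λ x → T.trans (h-cong G (h-neg H x)) (h-neg G _)
      ; h-0 = T.trans (h-cong G (h-0 H)) (h-0 G)
      ; h-1 = T.trans (h-cong G (h-1 H)) (h-1 G) }

  module _ {a ℓa b ℓb} {R : CommutativeRing a ℓa} {S : CommutativeRing b ℓb} {h} (H : IsHom R S h) where
    private
      module R = PolyLaws R
      module S = PolyLaws S
    open S using (_≋_; mk; at)
    open import Relation.Binary.Reasoning.Setoid S.setoid

    coeff-map : ∀ p k → S.coeff (map h p) k S.≈ h (R.coeff p k)
    coeff-map [] k = S.sym (h-0 H)
    coeff-map (x ∷ p) zero = S.refl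
    coeff-map (x ∷ p) (suc k) = coeff-map p k

    map-cong≋ : ∀ {p q} → p R.≋ q → map h p ≋ map h q
    map-cong≋ {p} {q} e = mk λ k → S.trans (coeff-map p k) (S.trans (h-cong H (R.at e k)) (S.sym (coeff-map q k)))

    map-+ : ∀ p q → map h (p R.+P q) ≋ (map h p S.+P map h q)
    map-+ p q = mk λ k → begin
      S.coeff (map h (p R.+P q)) k ≈⟨ coeff-map (p R.+P q) k ⟩
      h (R.coeff (p R.+P q) k) ≈⟨ h-cong H (R.coeff-+ p q k) ⟩
      h (R.coeff p k R.+ R.coeff q k) ≈⟨ h-+ H _ _ ⟩
      h (R.coeff p k) S.+ h (R.coeff q k) ≈⟨ S.sym (S.+-cong (coeff-map p k) (coeff-map q k)) ⟩
      S.coeff (map h p) k S.+ S.coeff (map h q) k ≈⟨ S.sym (S.coeff-+ (map h p) (map h q) k) ⟩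
      S.coeff (map h p S.+P map h q) k ∎

    map-neg : ∀ p → map h (R.-P p) ≋ (S.-P (map h p))
    map-neg p = mk λ k → begin
      S.coeff (map h (R.-P p)) k ≈⟨ coeff-map (R.-P p) k ⟩
      h (R.coeff (R.-P p) k) ≈⟨ h-cong H (R.coeff-neg p k) ⟩
      h (R.- R.coeff p k) ≈⟨ h-neg H _ ⟩
      S.- h (R.coeff p k) ≈⟨ S.-‿cong (S.sym (coeff-map p k)) ⟩
      S.- S.coeff (map h p) k ≈⟨ S.sym (S.coeff-neg (map h p) k) ⟩
      S.coeff (S.-P (map h p)) k ∎

    map-scale : ∀ x p → map h (R.scale x p) ≋ S.scale (h x) (map h p)
    map-scale x p = mk λ k → begin
      S.coeff (map h (R.scale x p)) k ≈⟨ coeff-map (R.scale x p) k ⟩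
      h (R.coeff (R.scale x p) k) ≈⟨ h-cong H (R.coeff-scale x p k) ⟩
      h (x R.* R.coeff p k) ≈⟨ h-* H _ _ ⟩
      h x S.* h (R.coeff p k) ≈⟨ S.*-congˡ (S.sym (coeff-map p k)) ⟩
      h x S.* S.coeff (map h p) k ≈⟨ S.sym (S.coeff-scale (h x) (map h p) k) ⟩
      S.coeff (S.scale (h x) (map h p)) k ∎

    map-* : ∀ p q → map h (p R.*P q) ≋ (map h p S.*P map h q)
    map-* [] q = S.≋-refl
    map-* (x ∷ p) q =
      S.≋-trans (map-+ (R.scale x q) (R.0# ∷ (p R.*P q)))
                (S.+P-cong (map-scale x q) (S.cons-cong (h-0 H) (map-* p q)))

    polyHom : IsHom (PolyCR R) (PolyCR S) (map h)
    polyHom = record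
      { h-cong = λ e → S.≋→≈P (map-cong≋ (R.≈P→≋ e))
      ; h-+ = λ p q → S.≋→≈P (map-+ p q)
      ; h-* = λ p q → S.≋→≈P (map-* p q)
      ; h-neg = λ p → S.≋→≈P (map-neg p)
      ; h-0 = S.≋→≈P (S.≋-refl {[]})
      ; h-1 = S.≋→≈P (S.cons-cong (h-1 H) (S.≋-refl {[]})) }

  iterHom : ∀ {a ℓa b ℓb} {R : CommutativeRing a ℓa} {S : CommutativeRing b ℓb} {h} → IsHom R S h →
    ∀ n → IsHom (iterCR n R) (iterCR n S) (mapIter {RA = CommutativeRing.rawRing R} {RB = CommutativeRing.rawRing S} n h)
  iterHom H zero = H
  iterHom H (suc n) = polyHom (iterHom H n)

  module _ {a ℓa} (R : CommutativeRing a ℓa) where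
    private
      module R = PolyLaws R
    constHom : IsHom R (PolyCR R) (λ x → x ∷ [])
    constHom = record
      { h-cong = λ e → R.≋→≈P (R.cons-cong e R.≋-refl)
      ; h-+ = λ x y → R.≋→≈P (R.≋-refl {x R.+ y ∷ []})
      ; h-* = λ x y → R.≋→≈P (R.cons-cong (R.sym (R.+-identityʳ _)) (R.≋-refl {[]}))
      ; h-neg = λ x → R.≋→≈P (R.≋-refl {R.- x ∷ []})
      ; h-0 = R.≋→≈P (R.cons-[] R.refl (R.≋-refl {[]}))
      ; h-1 = R.≋→≈P (R.≋-refl {R.1# ∷ []}) }

  constIHom : ∀ {a ℓa} (R : CommutativeRing a ℓa) n → IsHom R (iterCR n R) (constI (CommutativeRing.rawRing R) n)
  constIHom R zero = record
    { h-cong = λ e → e ; h-+ = λ _ _ → refl ; h-* = λ _ _ → refl ; h-neg = λ _ → refl ; h-0 = refl ; h-1 = refl }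
    where open CommutativeRing R
  constIHom R (suc n) = compHom (constIHom R n) (constHom (iterCR n R))

-- The determinant of Defs (Laplace expansion along the first row) is multilinear
-- in each column and vanishes when two adjacent columns agree; hence adding a
-- multiple of a column to the next one does not change it, and a common factor of
-- a column can be pulled out.
module Determinants where

  open PolynomialArithmetic
  open PolynomialRings
  open RingHomomorphisms
  open import Algebra.Bundles using (CommutativeRing)
  open import Data.Nat using (zero; suc)
  open import Data.Fin using (Fin; zero; suc; toℕ; punchIn; punchOut; inject₁)
  open import Data.Fin.Properties using (suc-injective; punchInᵢ≢i; punchIn-injective; punchIn-punchOut; toℕ-inject₁) renaming (_≟_ to _≟F_)
  open import Data.Bool using (true; false; if_then_else_; not)
  open import Data.Product using (Σ; _×_; _,_; proj₁; proj₂)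
  open import Data.Sum using (_⊎_; inj₁; inj₂)
  open import Data.Empty using (⊥-elim)
  open import Relation.Nullary using (yes; no)
  open import Relation.Binary.PropositionalEquality as Eq using (_≡_; _≢_; cong) renaming (refl to ≡-refl; sym to ≡-sym; trans to ≡-trans)
  open import Function using (_∘_)

  isEven-suc : ∀ m → isEven (suc m) ≡ not (isEven m)
  isEven-suc zero = ≡-refl
  isEven-suc (suc zero) = ≡-refl
  isEven-suc (suc (suc m)) = isEven-suc m

  adjMinor : ∀ {n} (j : Fin (suc (suc n))) (k : Fin (suc n)) → j ≢ inject₁ k → j ≢ suc k →
    Σ (Fin n) λ k' → (punchIn j (inject₁ k') ≡ inject₁ k) × (punchIn j (suc k') ≡ suc k)
  adjMinor zero zero h1 h2 = ⊥-elim (h1 ≡-refl)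
  adjMinor zero (suc k) h1 h2 = k , ≡-refl , ≡-refl
  adjMinor {zero} (suc zero) zero h1 h2 = ⊥-elim (h2 ≡-refl)
  adjMinor {suc n} (suc zero) zero h1 h2 = ⊥-elim (h2 ≡-refl)
  adjMinor {suc n} (suc (suc j)) zero h1 h2 = zero , ≡-refl , ≡-refl
  adjMinor {suc n} (suc j) (suc k) h1 h2 with adjMinor j k (h1 ∘ cong suc) (h2 ∘ cong suc)
  ... | k' , e1 , e2 = suc k' , cong suc e1 , cong suc e2

  -- deleting column k or column k+1 gives the same columns, up to exchanging k and k+1
  adjSwap : ∀ {n} (k : Fin n) (s : Fin n) →
    (punchIn (inject₁ k) s ≡ punchIn (suc k) s) ⊎ ((punchIn (inject₁ k) s ≡ suc k) × (punchIn (suc k) s ≡ inject₁ k))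
  adjSwap zero zero = inj₂ (≡-refl , ≡-refl)
  adjSwap zero (suc s) = inj₁ ≡-refl
  adjSwap (suc k) zero = inj₁ ≡-refl
  adjSwap (suc k) (suc s) with adjSwap k s
  ... | inj₁ e = inj₁ (cong suc e)
  ... | inj₂ (e1 , e2) = inj₂ (cong suc e1 , cong suc e2)

  module DetLaws {c ℓ} (R : CommutativeRing c ℓ) where
    open PolyLaws R public

    sgn : ∀ {n} → Fin n → Carrier → Carrier
    sgn j t = if isEven (toℕ j) then t else - t

    sgn-cong : ∀ {n} (j : Fin n) {x y} → x ≈ y → sgn j x ≈ sgn j y
    sgn-cong j e with isEven (toℕ j)
    ... | true = e
    ... | false = -‿cong e

    sgn-lin : ∀ {n} (j : Fin n) x a y → sgn j (x + a * y) ≈ sgn j x + a * sgn j y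
    sgn-lin j x a y with isEven (toℕ j)
    ... | true = refl
    ... | false = trans (sym (⁻¹-∙-comm x (a * y))) (+-congˡ (-‿distribʳ-* a y))
      where open import Algebra.Properties.AbelianGroup +-abelianGroup using (⁻¹-∙-comm)

    sgn-pair : ∀ {n} (k : Fin n) x → sgn (inject₁ k) x + sgn (suc k) x ≈ 0#
    sgn-pair k x rewrite toℕ-inject₁ k | isEven-suc (toℕ k) with isEven (toℕ k)
    ... | true = -‿inverseʳ x
    ... | false = -‿inverseˡ x

    sum-cong : ∀ n {v w : Fin n → Carrier} → (∀ j → v j ≈ w j) → sumFin n v ≈ sumFin n w
    sum-cong zero h = refl
    sum-cong (suc n) h = +-cong (h zero) (sum-cong n (h ∘ suc))

    sum-+ : ∀ n (v w : Fin n → Carrier) → sumFin n (λ j → v j + w j) ≈ sumFin n v + sumFin n w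
    sum-+ zero v w = sym (+-identityʳ 0#)
    sum-+ (suc n) v w = trans (+-congˡ (sum-+ n (v ∘ suc) (w ∘ suc))) (interchange (v zero) (w zero) _ _)

    sum-scale : ∀ n a (v : Fin n → Carrier) → sumFin n (λ j → a * v j) ≈ a * sumFin n v
    sum-scale zero a v = sym (zeroʳ a)
    sum-scale (suc n) a v = trans (+-congˡ (sum-scale n a (v ∘ suc))) (sym (distribˡ a _ _))

    sum-lin : ∀ n (v w : Fin n → Carrier) a → sumFin n (λ j → v j + a * w j) ≈ sumFin n v + a * sumFin n w
    sum-lin n v w a = trans (sum-+ n v (λ j → a * w j)) (+-congˡ (sum-scale n a w))

    sum-zero : ∀ n (v : Fin n → Carrier) → (∀ j → v j ≈ 0#) → sumFin n v ≈ 0#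
    sum-zero zero v h = refl
    sum-zero (suc n) v h = trans (+-cong (h zero) (sum-zero n (v ∘ suc) (h ∘ suc))) (+-identityʳ 0#)

    sum-pair : ∀ n (v : Fin (suc n) → Carrier) (k : Fin n) →
      (∀ j → j ≢ inject₁ k → j ≢ suc k → v j ≈ 0#) → v (inject₁ k) + v (suc k) ≈ 0# → sumFin (suc n) v ≈ 0#
    sum-pair (suc n) v zero h e = begin
      v zero + (v (suc zero) + sumFin n (λ j → v (suc (suc j)))) ≈⟨ sym (+-assoc _ _ _) ⟩
      (v zero + v (suc zero)) + sumFin n (λ j → v (suc (suc j))) ≈⟨ +-cong e (sum-zero n _ (λ j → h (suc (suc j)) (λ ()) (λ ()))) ⟩
      0# + 0# ≈⟨ +-identityʳ 0# ⟩
      0# ∎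
    sum-pair (suc n) v (suc k) h e =
      trans (+-cong (h zero (λ ()) (λ ())) (sum-pair n (v ∘ suc) k (λ j a b → h (suc j) (a ∘ suc-injective) (b ∘ suc-injective)) e)) (+-identityʳ 0#)

    minor : ∀ {n} → Fin (suc n) → (Fin (suc n) → Fin (suc n) → Carrier) → Fin n → Fin n → Carrier
    minor j M r s = M (suc r) (punchIn j s)

    det-cong : ∀ n {M N : Fin n → Fin n → Carrier} → (∀ t u → M t u ≈ N t u) → det n M ≈ det n N
    det-cong zero h = refl
    det-cong (suc n) {M} {N} h = sum-cong (suc n) λ j →
      sgn-cong j (*-cong (h zero j) (det-cong n (λ r s → h (suc r) (punchIn j s))))

    sgn0 : ∀ {n} (j : Fin n) → sgn j 0# ≈ 0#
    sgn0 j with isEven (toℕ j)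
    ... | true = refl
    ... | false = -0#≈0#

    -- the two ways a term of the Laplace expansion splits, according to whether the
    -- column being split is j or lies inside the minor
    private
      split-entry : ∀ x a y D D₁ D₂ → D ≈ D₁ → D ≈ D₂ → (x + a * y) * D ≈ x * D₁ + a * (y * D₂)
      split-entry x a y D D₁ D₂ e1 e2 = begin
        (x + a * y) * D ≈⟨ distribʳ D x (a * y) ⟩
        x * D + (a * y) * D ≈⟨ +-cong (*-congˡ e1) (trans (*-assoc a y D) (*-congˡ (*-congˡ e2))) ⟩
        x * D₁ + a * (y * D₂) ∎
      split-minor : ∀ x x₁ x₂ a D₁ D₂ → x ≈ x₁ → x ≈ x₂ → x * (D₁ + a * D₂) ≈ x₁ * D₁ + a * (x₂ * D₂)
      split-minor x x₁ x₂ a D₁ D₂ e1 e2 = begin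
        x * (D₁ + a * D₂) ≈⟨ distribˡ x D₁ (a * D₂) ⟩
        x * D₁ + x * (a * D₂) ≈⟨ +-congˡ (sym (*-assoc x a D₂)) ⟩
        x * D₁ + (x * a) * D₂ ≈⟨ +-congˡ (*-congʳ (*-comm x a)) ⟩
        x * D₁ + (a * x) * D₂ ≈⟨ +-congˡ (*-assoc a x D₂) ⟩
        x * D₁ + a * (x * D₂) ≈⟨ +-cong (*-congʳ e1) (*-congˡ (*-congʳ e2)) ⟩
        x₁ * D₁ + a * (x₂ * D₂) ∎

    det-lin : ∀ n (M M₁ M₂ : Fin n → Fin n → Carrier) (col : Fin n) (a : Carrier) →
      (∀ t u → u ≢ col → (M t u ≈ M₁ t u) × (M t u ≈ M₂ t u)) →
      (∀ t → M t col ≈ M₁ t col + a * M₂ t col) →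
      det n M ≈ det n M₁ + a * det n M₂
    det-lin (suc n) M M₁ M₂ col a hoff hon =
      trans (sum-cong (suc n) term) (sum-lin (suc n) (λ j → sgn j (M₁ zero j * det n (minor j M₁))) (λ j → sgn j (M₂ zero j * det n (minor j M₂))) a)
      where
      term : ∀ j → sgn j (M zero j * det n (minor j M)) ≈
                   sgn j (M₁ zero j * det n (minor j M₁)) + a * sgn j (M₂ zero j * det n (minor j M₂))
      term j with j ≟F col
      ... | yes ≡-refl = trans (sgn-cong j (trans (*-congʳ (hon zero)) (split-entry _ a _ _ _ _
              (det-cong n (λ r s → proj₁ (hoff (suc r) (punchIn j s) (punchInᵢ≢i j s))))
              (det-cong n (λ r s → proj₂ (hoff (suc r) (punchIn j s) (punchInᵢ≢i j s)))))))
              (sgn-lin j _ a _)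
      ... | no j≢c = trans (sgn-cong j (trans (*-congˡ ih) (split-minor _ _ _ a _ _ (proj₁ (hoff zero j j≢c)) (proj₂ (hoff zero j j≢c))))) (sgn-lin j _ a _)
        where
        c' = punchOut j≢c
        pp : punchIn j c' ≡ col
        pp = punchIn-punchOut j≢c
        ih : det n (minor j M) ≈ det n (minor j M₁) + a * det n (minor j M₂)
        ih = det-lin n (minor j M) (minor j M₁) (minor j M₂) c' a
          (λ r s s≢c' → hoff (suc r) (punchIn j s) (λ e → s≢c' (punchIn-injective j s c' (≡-trans e (≡-sym pp)))))
          (λ r → trans (reflexive (cong (M (suc r)) pp)) (trans (hon (suc r))
                  (+-cong (reflexive (cong (M₁ (suc r)) (≡-sym pp))) (*-congˡ (reflexive (cong (M₂ (suc r)) (≡-sym pp)))))))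

    det-adj : ∀ n (M : Fin (suc n) → Fin (suc n) → Carrier) (k : Fin n) →
      (∀ t → M t (inject₁ k) ≈ M t (suc k)) → det (suc n) M ≈ 0#
    det-adj (suc n) M k hk = sum-pair (suc n) T k others pair
      where
      T : Fin (suc (suc n)) → Carrier
      T j = sgn j (M zero j * det (suc n) (minor j M))
      others : ∀ j → j ≢ inject₁ k → j ≢ suc k → T j ≈ 0#
      others j h1 h2 with adjMinor j k h1 h2
      ... | k' , e1 , e2 = trans (sgn-cong j (trans (*-congˡ (det-adj n (minor j M) k'
              (λ t → trans (reflexive (cong (M (suc t)) e1)) (trans (hk (suc t)) (reflexive (cong (M (suc t)) (≡-sym e2)))))))
              (zeroʳ _))) (sgn0 j)
      mm : ∀ r s → minor (inject₁ k) M r s ≈ minor (suc k) M r s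
      mm r s with adjSwap k s
      ... | inj₁ e = reflexive (cong (M (suc r)) e)
      ... | inj₂ (e1 , e2) = trans (reflexive (cong (M (suc r)) e1)) (trans (sym (hk (suc r))) (reflexive (cong (M (suc r)) (≡-sym e2))))
      pair : T (inject₁ k) + T (suc k) ≈ 0#
      pair = trans (+-congʳ (sgn-cong (inject₁ k) (*-cong (hk zero) (det-cong (suc n) mm)))) (sgn-pair k _)

    upd : ∀ {n} → (Fin n → Fin n → Carrier) → Fin n → (Fin n → Carrier) → Fin n → Fin n → Carrier
    upd M col v t u with u ≟F col
    ... | yes _ = v t
    ... | no _ = M t u

    upd-on : ∀ {n} M (col : Fin n) v t → upd M col v t col ≈ v t
    upd-on M col v t with col ≟F col
    ... | yes _ = refl
    ... | no ne = ⊥-elim (ne ≡-refl)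

    upd-off : ∀ {n} M (col : Fin n) v t u → u ≢ col → upd M col v t u ≈ M t u
    upd-off M col v t u ne with u ≟F col
    ... | yes e = ⊥-elim (ne e)
    ... | no _ = refl

    zero-col : ∀ n (M : Fin n → Fin n → Carrier) col → (∀ t → M t col ≈ 0#) → det n M ≈ 0#
    zero-col n M col h = x+x≈x⇒x≈0 (det n M) (sym (trans e (+-congˡ (*-identityˡ _))))
      where
      e : det n M ≈ det n M + 1# * det n M
      e = det-lin n M M M col 1# (λ t u _ → refl , refl)
            (λ t → trans (h t) (sym (trans (+-cong (h t) (trans (*-congˡ (h t)) (zeroʳ 1#))) (+-identityʳ 0#))))

    factor-col : ∀ n (M : Fin n → Fin n → Carrier) col (a : Carrier) (W : Fin n → Carrier) →
      (∀ t → M t col ≈ a * W t) → det n M ≈ a * det n (upd M col W)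
    factor-col n M col a W h =
      trans (det-lin n M (upd M col (λ _ → 0#)) (upd M col W) col a
               (λ t u ne → sym (upd-off M col _ t u ne) , sym (upd-off M col W t u ne))
               (λ t → trans (h t) (trans (sym (+-identityˡ _)) (sym (+-cong (upd-on M col _ t) (*-congˡ (upd-on M col W t)))))))
            (trans (+-congʳ (zero-col n _ col (λ t → upd-on M col _ t))) (+-identityˡ _))

    col-op : ∀ n (M M' : Fin (suc n) → Fin (suc n) → Carrier) (k : Fin n) (a : Carrier) →
      (∀ t u → u ≢ suc k → M' t u ≈ M t u) →
      (∀ t → M' t (suc k) ≈ M t (suc k) + a * M t (inject₁ k)) →
      det (suc n) M' ≈ det (suc n) M
    col-op n M M' k a hoff hon =
      trans (det-lin (suc n) M' M M₂ (suc k) a (λ t u ne → hoff t u ne , trans (hoff t u ne) (sym (upd-off M (suc k) _ t u ne)))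
               (λ t → trans (hon t) (+-congˡ (*-congˡ (sym (upd-on M (suc k) _ t))))))
            (trans (+-congˡ (trans (*-congˡ d0) (zeroʳ a))) (+-identityʳ _))
      where
      M₂ = upd M (suc k) (λ t → M t (inject₁ k))
      d0 : det (suc n) M₂ ≈ 0#
      d0 = det-adj n M₂ k (λ t → trans (upd-off M (suc k) _ t (inject₁ k) (ne k)) (sym (upd-on M (suc k) _ t)))
        where
        ne : ∀ {m} (k : Fin m) → inject₁ k ≢ suc k
        ne zero ()
        ne (suc k) e = ne k (suc-injective e)

  module DetHom {a ℓa b ℓb} {R : CommutativeRing a ℓa} {S : CommutativeRing b ℓb} {h} (H : IsHom R S h) where
    private
      module R = DetLaws R
      module S = DetLaws S
    sum-hom : ∀ n (v : Fin n → R.Carrier) → h (R.sumFin n v) S.≈ S.sumFin n (h ∘ v)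
    sum-hom zero v = h-0 H
    sum-hom (suc n) v = S.trans (h-+ H _ _) (S.+-congˡ (sum-hom n (v ∘ suc)))

    sgn-hom : ∀ {n} (j : Fin n) x → h (R.sgn j x) S.≈ S.sgn j (h x)
    sgn-hom j x with isEven (toℕ j)
    ... | true = S.refl
    ... | false = h-neg H x

    det-hom : ∀ n (M : Fin n → Fin n → R.Carrier) → h (R.det n M) S.≈ S.det n (λ t u → h (M t u))
    det-hom zero M = h-1 H
    det-hom (suc n) M = S.trans (sum-hom (suc n) (λ j → R.sgn j (M zero j R.* R.det n (R.minor j M)))) (S.sum-cong (suc n) λ j →
      S.trans (sgn-hom j (M zero j R.* R.det n (R.minor j M))) (S.sgn-cong j (S.trans (h-* H _ _) (S.*-congˡ (det-hom n (R.minor j M))))))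

-- Bookkeeping for Sylvester matrices: the shift x^e · f, polynomials given by a
-- coefficient function, divisibility of polynomials, and the statement that the
-- row (s, f) of a Sylvester matrix lists, read from right to left, the
-- coefficients of the shift x^e · f.
module ShiftsAndRows where

  open PolynomialArithmetic
  open PolynomialRings
  open RingHomomorphisms
  open import Level using (_⊔_)
  open import Algebra.Bundles using (CommutativeRing)
  open import Data.Nat using (ℕ; zero; suc; _∸_) renaming (_+_ to _+ℕ_)
  open import Data.Nat using (_≤ᵇ_; _≤_; _<_; _≤?_; z≤n; s≤s)
  import Data.Nat.Properties as ℕP
  import Data.Nat as ℕ
  open import Data.Nat.Properties
    using (m∸n≤m; [m+n]∸[m+o]≡n∸o; m∸[m∸n]≡n; ≤-reflexive; m<n+m; m≤n+m; ≤⇒≤ᵇ; ≤ᵇ⇒≤; m≤m+n; m+n∸m≡n;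
           <-irrefl; ≤-trans; <⇒≤; ≰⇒>; <-≤-trans; ≤-<-trans)
  open import Data.List using (List; []; _∷_; map; applyUpTo; length)
  open import Data.Fin using (Fin; zero; suc)
  open import Data.Bool using (true; false)
  open import Data.Product using (Σ; _,_)
  open import Data.Empty using (⊥-elim)
  open import Relation.Nullary using (¬_; yes; no)
  open import Relation.Binary.PropositionalEquality as Eq using (_≡_; _≢_; cong) renaming (refl to ≡-refl; sym to ≡-sym; trans to ≡-trans)
  open import Function using (_∘_)

  -- prepend e copies of z (for polynomials: multiply by x^e)
  sh : ∀ {a} {A : Set a} → A → ℕ → List A → List A
  sh z zero p = p
  sh z (suc e) p = z ∷ sh z e p

  map-applyUpTo : ∀ {a b} {A : Set a} {B : Set b} (g : A → B) (f : ℕ → A) m → map g (applyUpTo f m) ≡ applyUpTo (g ∘ f) m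
  map-applyUpTo g f zero = ≡-refl
  map-applyUpTo g f (suc m) = cong (g (f zero) ∷_) (map-applyUpTo g (f ∘ suc) m)

  ≤-split : ∀ {m n} → m ≤ n → Σ ℕ λ o → n ≡ m +ℕ o
  ≤-split {n = n} z≤n = n , ≡-refl
  ≤-split (s≤s le) with ≤-split le
  ... | o , e = o , cong suc e

  ≤ᵇ-true : ∀ {m n} → m ≤ n → (m ≤ᵇ n) ≡ true
  ≤ᵇ-true {m} {n} le with m ≤ᵇ n | ≤⇒≤ᵇ le
  ... | true | _ = ≡-refl

  ≤ᵇ-false : ∀ {m n} → ¬ (m ≤ n) → (m ≤ᵇ n) ≡ false
  ≤ᵇ-false {m} {n} nle with m ≤ᵇ n | ≤ᵇ⇒≤ m n
  ... | true | f = ⊥-elim (nle (f _))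
  ... | false | _ = ≡-refl

  ≡ᵇ-true : ∀ {m n} → m ≡ n → (m ℕ.≡ᵇ n) ≡ true
  ≡ᵇ-true {m} {n} e with m ℕ.≡ᵇ n | ℕP.≡⇒≡ᵇ m n e
  ... | true | _ = ≡-refl

  ≡ᵇ-false : ∀ {m n} → m ≢ n → (m ℕ.≡ᵇ n) ≡ false
  ≡ᵇ-false {m} {n} ne with m ℕ.≡ᵇ n | ℕP.≡ᵇ⇒≡ m n
  ... | true | f = ⊥-elim (ne (f _))
  ... | false | _ = ≡-refl

  module Divisibility {c ℓ} (R : CommutativeRing c ℓ) where
    open PolyLaws R public

    Deg≤ : Poly → ℕ → Set ℓ
    Deg≤ p n = ∀ k → n < k → coeff p k ≈ 0#

    coeff-len : ∀ W k → length W ≤ k → coeff W k ≈ 0#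
    coeff-len [] k _ = refl
    coeff-len (w ∷ W) (suc k) (s≤s le) = coeff-len W k le

    degLen : ∀ W → Deg≤ W (length W)
    degLen W k lt = coeff-len W k (ℕP.<⇒≤ lt)

    shP : ℕ → Poly → Poly
    shP = sh 0#

    coeff-sh-hi : ∀ e f j → coeff (shP e f) (e +ℕ j) ≡ coeff f j
    coeff-sh-hi zero f j = ≡-refl
    coeff-sh-hi (suc e) f j = coeff-sh-hi e f j

    coeff-sh-lo : ∀ e f k → k < e → coeff (shP e f) k ≈ 0#
    coeff-sh-lo (suc e) f zero _ = refl
    coeff-sh-lo (suc e) f (suc k) (s≤s lt) = coeff-sh-lo e f k lt

    sh-cong : ∀ e {p q} → p ≋ q → shP e p ≋ shP e q
    sh-cong zero E = E
    sh-cong (suc e) E = cons-cong refl (sh-cong e E)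

    sh-[] : ∀ e → shP e [] ≋ []
    sh-[] zero = ≋-refl
    sh-[] (suc e) = cons-[] refl (sh-[] e)

    sh-*ˡ : ∀ e A B → (shP e A *P B) ≋ shP e (A *P B)
    sh-*ˡ zero A B = ≋-refl
    sh-*ˡ (suc e) A B = ≋-trans (cons0-* (shP e A) B) (cons-cong refl (sh-*ˡ e A B))

    sh-*ʳ : ∀ e A B → (A *P shP e B) ≋ shP e (A *P B)
    sh-*ʳ e A B = ≋-trans (*P-comm A (shP e B)) (≋-trans (sh-*ˡ e B A) (sh-cong e (*P-comm B A)))

    coeff-tab-lo : ∀ (a : ℕ → Carrier) m k → k < m → coeff (applyUpTo a m) k ≈ a k
    coeff-tab-lo a (suc m) zero lt = refl
    coeff-tab-lo a (suc m) (suc k) (s≤s lt) = coeff-tab-lo (a ∘ suc) m k lt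

    coeff-tab-hi : ∀ (a : ℕ → Carrier) m k → m ≤ k → coeff (applyUpTo a m) k ≈ 0#
    coeff-tab-hi a zero k _ = refl
    coeff-tab-hi a (suc m) (suc k) (s≤s le) = coeff-tab-hi (a ∘ suc) m k le

    tab-suc : ∀ (a : ℕ → Carrier) m → applyUpTo a (suc m) ≋ (applyUpTo a m +P shP m (a m ∷ []))
    tab-suc a zero = ≋-refl
    tab-suc a (suc m) = cons-cong (sym (+-identityʳ _)) (tab-suc (a ∘ suc) m)

    infix 4 _∣≋_
    _∣≋_ : Poly → Poly → Set (c ⊔ ℓ)
    H ∣≋ P = Σ Poly λ W → (H *P W) ≋ P

    ∣-cong : ∀ {H P Q} → P ≋ Q → H ∣≋ P → H ∣≋ Q
    ∣-cong e (W , w) = W , ≋-trans w e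

    ∣-+ : ∀ {H P Q} → H ∣≋ P → H ∣≋ Q → H ∣≋ (P +P Q)
    ∣-+ {H} (W , w) (V , v) = (W +P V) , ≋-trans (*P-distribˡ H W V) (+P-cong w v)

    ∣-*ˡ : ∀ {H P} Q → H ∣≋ P → H ∣≋ (Q *P P)
    ∣-*ˡ {H} {P} Q (W , w) = (Q *P W) , ≋-trans (≋-sym (*P-assoc H Q W)) (≋-trans (*P-congˡ W (*P-comm H Q)) (≋-trans (*P-assoc Q H W) (*P-congʳ Q w)))

    ∣-[] : ∀ H → H ∣≋ []
    ∣-[] H = [] , *P-[]ʳ H

    ∣-sum : ∀ {G} k (v : Fin k → Poly) → (∀ j → G ∣≋ v j) → G ∣≋ sumFinP k v
    ∣-sum {G} zero v h = ∣-[] G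
    ∣-sum {G} (suc k) v h = ∣-+ {G} (h zero) (∣-sum {G} k (v ∘ suc) (h ∘ suc))

    ∣-sh : ∀ {H P} e → H ∣≋ P → H ∣≋ shP e P
    ∣-sh {H} e (W , w) = shP e W , ≋-trans (sh-*ʳ e H W) (sh-cong e w)

    fromDiv : ∀ {H P} → H ∣P P → H ∣≋ P
    fromDiv (W , w) = W , ≈P→≋ w
    toDiv : ∀ {H P} → H ∣≋ P → H ∣P P
    toDiv (W , w) = W , ≋→≈P w

    sylRow-in : ∀ p f s r → r ≤ p → sylRow p f s (s +ℕ r) ≈ coeff f (p ∸ r)
    sylRow-in p f s r r≤p rewrite ≤ᵇ-true (m≤m+n s r) | m+n∸m≡n s r | ≤ᵇ-true r≤p = refl

    sylRow-lo : ∀ p f s c0 → c0 < s → sylRow p f s c0 ≈ 0#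
    sylRow-lo p f s c0 lt rewrite ≤ᵇ-false (λ le → <-irrefl ≡-refl (<-≤-trans lt le)) = refl

    sylRow-hi : ∀ p f s r → p < r → sylRow p f s (s +ℕ r) ≈ 0#
    sylRow-hi p f s r lt rewrite ≤ᵇ-true (m≤m+n s r) | m+n∸m≡n s r | ≤ᵇ-false {r} {p} (λ le → <-irrefl ≡-refl (<-≤-trans lt le)) = refl

    private
      beforeRow : ∀ s p j → j ≤ s +ℕ p → p < j → (s +ℕ p) ∸ j < s
      beforeRow s zero (suc j) le lt with s | le
      ... | suc s' | s≤s le' rewrite ℕP.+-identityʳ s' = s≤s (m∸n≤m s' j)
      ... | zero | ()
      beforeRow s (suc p) (suc j) le (s≤s lt) rewrite ℕP.+-suc s p = beforeRow s p j (ℕP.≤-pred le) lt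

    shiftedRow : ∀ p f s e → Deg≤ f p → ∀ k → k ≤ e +ℕ (s +ℕ p) → coeff (shP e f) k ≈ sylRow p f s ((e +ℕ (s +ℕ p)) ∸ k)
    shiftedRow p f s e dg k k≤E with e ≤? k
    ... | yes e≤k with ≤-split e≤k
    ...   | j , ≡-refl rewrite coeff-sh-hi e f j | [m+n]∸[m+o]≡n∸o e (s +ℕ p) j with j ≤? p
    ...     | yes j≤p rewrite ℕP.+-∸-assoc s j≤p = trans (reflexive (cong (coeff f) (≡-sym (m∸[m∸n]≡n j≤p)))) (sym (sylRow-in p f s (p ∸ j) (m∸n≤m p j)))
    ...     | no j≰p = trans (dg j (≰⇒> j≰p)) (sym (sylRow-lo p f s _ (beforeRow s p j (ℕP.+-cancelˡ-≤ e j (s +ℕ p) k≤E) (≰⇒> j≰p))))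
    shiftedRow p f s e dg k k≤E | no e≰k with ≤-split (<⇒≤ (≰⇒> e≰k))
    ... | d , ≡-refl = trans (coeff-sh-lo (k +ℕ d) f k (≰⇒> e≰k)) (sym (trans (reflexive (cong (sylRow p f s) eqn)) (sylRow-hi p f s (d +ℕ p) (m<n+m p dpos))))
      where
      dpos' : ∀ d → ¬ (k +ℕ d ≤ k) → 0 < d
      dpos' zero h = ⊥-elim (h (≤-reflexive (ℕP.+-identityʳ k)))
      dpos' (suc _) _ = s≤s z≤n
      dpos : 0 < d
      dpos = dpos' d e≰k
      eqn : (k +ℕ d +ℕ (s +ℕ p)) ∸ k ≡ s +ℕ (d +ℕ p)
      eqn = ≡-trans (cong (_∸ k) (ℕP.+-assoc k d (s +ℕ p))) (≡-trans (m+n∸m≡n k (d +ℕ (s +ℕ p)))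
             (≡-trans (≡-sym (ℕP.+-assoc d s p)) (≡-trans (cong (_+ℕ p) (ℕP.+-comm d s)) (ℕP.+-assoc s d p))))

    shiftedRow-above : ∀ p f s e → Deg≤ f p → ∀ k → e +ℕ (s +ℕ p) < k → coeff (shP e f) k ≈ 0#
    shiftedRow-above p f s e dg k lt with ≤-split (≤-trans (m≤m+n e (s +ℕ p)) (<⇒≤ lt))
    ... | j , ≡-refl rewrite coeff-sh-hi e f j = dg j (≤-<-trans (m≤n+m p s) (ℕP.+-cancelˡ-< e (s +ℕ p) j lt))

-- Let Z be an (n'+1)-row matrix with
-- columns 0, …, E = n' + i, and let coeffDet j be the determinant of its first n'
-- columns together with column E - j.  Then the polynomial Σ_{j ≤ i} coeffDet j x^j
-- is the determinant of a polynomial matrix whose last column consists of the row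
-- polynomials Σ_{k ≤ E} Z t (E - k) x^k.  Hence any common divisor H of the row
-- polynomials divides Σ_{j ≤ i} coeffDet j x^j.
--
-- The polynomial matrix is reached in three steps, each preserving the determinant:
--   Trunc: the first n' columns of Z as constants, last column Σ_{j < i+1} Z t (E-j) x^j
--          (its determinant is Σ_{j ≤ i} coeffDet j x^j by linearity in the last column);
--   Acc:   columns u < n' replaced by rowHead (u+1), i.e. Σ_{k ≤ u} Z t k x^(u-k),
--          by adding x · (column u-1) to column u, left to right;
--   Row:   finally adding x^(i+1) · (column n'-1) to the last column, which completes
--          it to the row polynomial.
module BorderedDeterminant where

  open PolynomialArithmetic
  open PolynomialRings
  open RingHomomorphisms
  open Determinants
  open ShiftsAndRows
  open import Algebra.Bundles using (CommutativeRing)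
  open import Data.Nat using (ℕ; zero; suc; _∸_) renaming (_+_ to _+ℕ_)
  open import Data.Nat using (_≤_; _<_; _≤?_; z≤n; s≤s)
  open import Data.Nat.Properties using (_≟_; <-irrefl; <⇒≤; ≰⇒>; <-≤-trans; ≤-reflexive; m≤m+n)
  import Data.Nat.Properties as ℕP
  open import Data.Fin using (Fin; suc; toℕ; fromℕ; fromℕ<; inject₁)
  open import Data.Fin.Properties using (toℕ-fromℕ; toℕ-fromℕ<; toℕ-injective; toℕ-inject₁)
  open import Data.List using ([]; _∷_; applyUpTo)
  open import Data.Bool using (if_then_else_)
  open import Data.Product using (Σ; _×_; _,_; proj₁; proj₂)
  open import Relation.Nullary using (¬_; yes; no; does)
  open import Relation.Binary.PropositionalEquality as Eq using (_≡_; _≢_; cong) renaming (refl to ≡-refl; sym to ≡-sym; trans to ≡-trans)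
  import Data.Sum

  module Bordered {c ℓ} (R : CommutativeRing c ℓ) where
    open Divisibility R
    module D0 = DetLaws R
    RX = PolyCR R
    module DX = DetLaws RX
    module HC = DetHom (constHom R)

    module Expansion (n' i : ℕ) (Z : ℕ → ℕ → Carrier) where
      E : ℕ
      E = n' +ℕ i
      lastCol : ℕ → ℕ → ℕ
      lastCol j u = if does (u ≟ n') then E ∸ j else u
      coeffMatrix : ℕ → Fin (suc n') → Fin (suc n') → Carrier
      coeffMatrix j t u = Z (toℕ t) (lastCol j (toℕ u))
      coeffDet : ℕ → Carrier
      coeffDet j = D0.det (suc n') (coeffMatrix j)

      entry : Fin (suc n') → Fin (suc n') → Poly
      entry t u = Z (toℕ t) (toℕ u) ∷ []
      truncRow : ℕ → Fin (suc n') → Poly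
      truncRow m t = applyUpTo (λ j → Z (toℕ t) (E ∸ j)) m
      Trunc : ℕ → Fin (suc n') → Fin (suc n') → Poly
      Trunc m t u = if does (toℕ u ≟ n') then truncRow m t else entry t u

      last : Fin (suc n')
      last = fromℕ n'
      tl : toℕ last ≡ n'
      tl = toℕ-fromℕ n'
      notLast : ∀ {u} → u ≢ last → toℕ u ≢ n'
      notLast {u} ne e = ne (toℕ-injective (≡-trans e (≡-sym tl)))

      Trunc-last : ∀ m t u → toℕ u ≡ n' → Trunc m t u ≡ truncRow m t
      Trunc-last m t u e rewrite ≡ᵇ-true e = ≡-refl
      Trunc-other : ∀ m t u → toℕ u ≢ n' → Trunc m t u ≡ entry t u
      Trunc-other m t u ne rewrite ≡ᵇ-false ne = ≡-refl
      coeffMatrix-last : ∀ j t u → toℕ u ≡ n' → coeffMatrix j t u ≡ Z (toℕ t) (E ∸ j)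
      coeffMatrix-last j t u e rewrite ≡ᵇ-true e = ≡-refl
      coeffMatrix-other : ∀ j t u → toℕ u ≢ n' → coeffMatrix j t u ≡ Z (toℕ t) (toℕ u)
      coeffMatrix-other j t u ne rewrite ≡ᵇ-false ne = ≡-refl

      Trunc-det : ∀ m → DX.det (suc n') (Trunc m) ≋ applyUpTo coeffDet m
      Trunc-det zero = ≈P→≋ (DX.zero-col (suc n') (Trunc zero) last
                         (λ t → ≋→≈P (≋-reflexive (Trunc-last zero t last tl))))
      Trunc-det (suc m) = PR.begin
          DX.det (suc n') (Trunc (suc m))                            PR.≈⟨ ≈P→≋ linear ⟩
          DX.det (suc n') (Trunc m) +P (shP m 1P *P DX.det (suc n') C) PR.≈⟨ +P-cong (Trunc-det m) new-term ⟩
          applyUpTo coeffDet m +P shP m (coeffDet m ∷ [])              PR.≈⟨ ≋-sym (tab-suc coeffDet m) ⟩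
          applyUpTo coeffDet (suc m)                                   PR.∎
        where
        C : Fin (suc n') → Fin (suc n') → Poly
        C t u = coeffMatrix m t u ∷ []
        new-term : (shP m 1P *P DX.det (suc n') C) ≋ shP m (coeffDet m ∷ [])
        new-term = ≋-trans (sh-*ˡ m 1P _) (sh-cong m (≋-trans (*P-idˡ _)
                     (≋-sym (≈P→≋ (HC.det-hom (suc n') (coeffMatrix m))))))
        off : ∀ t u → u ≢ last → (Trunc (suc m) t u ≈P Trunc m t u) × (Trunc (suc m) t u ≈P C t u)
        off t u ne =
          ≋→≈P (≋-trans (≋-reflexive (Trunc-other (suc m) t u (notLast ne)))
                        (≋-reflexive (≡-sym (Trunc-other m t u (notLast ne))))) ,
          ≋→≈P (≋-trans (≋-reflexive (Trunc-other (suc m) t u (notLast ne)))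
                        (≋-reflexive (cong (_∷ []) (≡-sym (coeffMatrix-other m t u (notLast ne))))))
        on : ∀ t → Trunc (suc m) t last ≈P (Trunc m t last +P (shP m 1P *P C t last))
        on t = ≋→≈P (PR.begin
          Trunc (suc m) t last                                 PR.≈⟨ ≋-reflexive (Trunc-last (suc m) t last tl) ⟩
          truncRow (suc m) t                                   PR.≈⟨ tab-suc (λ j → Z (toℕ t) (E ∸ j)) m ⟩
          truncRow m t +P shP m (Z (toℕ t) (E ∸ m) ∷ [])       PR.≈⟨ +P-cong (≋-reflexive (≡-sym (Trunc-last m t last tl))) x^m·entry ⟩
          Trunc m t last +P (shP m 1P *P C t last)             PR.∎)
          where
          x^m·entry : shP m (Z (toℕ t) (E ∸ m) ∷ []) ≋ (shP m 1P *P C t last)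
          x^m·entry = ≋-trans (sh-cong m (≋-sym (*P-idˡ _))) (≋-trans (≋-sym (sh-*ˡ m 1P _))
                        (*P-congʳ (shP m 1P) (≋-reflexive (cong (_∷ []) (≡-sym (coeffMatrix-last m t last tl))))))
        linear : DX.det (suc n') (Trunc (suc m)) ≈P (DX.det (suc n') (Trunc m) +P (shP m 1P *P DX.det (suc n') C))
        linear = DX.det-lin (suc n') (Trunc (suc m)) (Trunc m) C last (shP m 1P) off on

      -- rowHead m t = Σ_{k < m} Z t k x^(m-1-k);  Acc m has its columns u < m replaced
      -- by rowHead (u+1)
      rowHead : ℕ → Fin (suc n') → Poly
      rowHead zero t = []
      rowHead (suc m) t = (Z (toℕ t) m ∷ []) +P (0# ∷ rowHead m t)

      Acc : ℕ → Fin (suc n') → Fin (suc n') → Poly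
      Acc m t u = if does (toℕ u ≟ n') then truncRow (suc i) t else (if does (suc (toℕ u) ≤? m) then rowHead (suc (toℕ u)) t else entry t u)

      Acc-last : ∀ m t u → toℕ u ≡ n' → Acc m t u ≡ truncRow (suc i) t
      Acc-last m t u e rewrite ≡ᵇ-true e = ≡-refl
      Acc-done : ∀ m t u → toℕ u ≢ n' → toℕ u < m → Acc m t u ≡ rowHead (suc (toℕ u)) t
      Acc-done m t u ne lt rewrite ≡ᵇ-false ne | ≤ᵇ-true lt = ≡-refl
      Acc-todo : ∀ m t u → toℕ u ≢ n' → ¬ (toℕ u < m) → Acc m t u ≡ entry t u
      Acc-todo m t u ne nlt rewrite ≡ᵇ-false ne | ≤ᵇ-false nlt = ≡-refl

      x*P : ∀ P → (shP 1 1P *P P) ≋ (0# ∷ P)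
      x*P P = ≋-trans (sh-*ˡ 1 1P P) (cons-cong refl (*P-idˡ P))

      Acc-det : ∀ m → m ≤ n' → DX.det (suc n') (Acc m) ≈P DX.det (suc n') (Trunc (suc i))
      Acc-det zero _ = DX.det-cong (suc n') λ t u → ≋→≈P (pt t u)
        where
        pt : ∀ t u → Acc zero t u ≋ Trunc (suc i) t u
        pt t u with toℕ u ≟ n'
        ... | yes e = ≋-trans (≋-reflexive (Acc-last zero t u e)) (≋-reflexive (≡-sym (Trunc-last (suc i) t u e)))
        ... | no ne = ≋-trans (≋-reflexive (Acc-todo zero t u ne (λ ()))) (≋-reflexive (≡-sym (Trunc-other (suc i) t u ne)))
      Acc-det (suc zero) le = DX.trans (DX.det-cong (suc n') λ t u → ≋→≈P (pt t u)) (Acc-det zero z≤n)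
        where
        pt : ∀ t u → Acc 1 t u ≋ Acc 0 t u
        pt t u with toℕ u ≟ n'
        ... | yes e = ≋-trans (≋-reflexive (Acc-last 1 t u e)) (≋-reflexive (≡-sym (Acc-last 0 t u e)))
        ... | no ne with toℕ u ≟ 0
        ...   | yes e0 = PR.begin
            Acc 1 t u                     PR.≈⟨ ≋-reflexive (Acc-done 1 t u ne (≤-reflexive (cong suc e0))) ⟩
            rowHead (suc (toℕ u)) t       PR.≈⟨ ≋-reflexive (cong (λ x → rowHead (suc x) t) e0) ⟩
            rowHead 1 t                   PR.≈⟨ cons-cong (+-identityʳ _) ≋-refl ⟩
            Z (toℕ t) 0 ∷ []              PR.≈⟨ ≋-reflexive (cong (λ x → Z (toℕ t) x ∷ []) (≡-sym e0)) ⟩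
            entry t u                     PR.≈⟨ ≋-reflexive (≡-sym (Acc-todo 0 t u ne (λ ()))) ⟩
            Acc 0 t u                     PR.∎
        ...   | no n0 = ≋-trans (≋-reflexive (Acc-todo 1 t u ne (λ lt → n0 (ℕP.n≤0⇒n≡0 (ℕP.≤-pred lt)))))
                                (≋-reflexive (≡-sym (Acc-todo 0 t u ne (λ ()))))
      -- column m+1 of Acc (m+2) is x · (column m of Acc (m+1)) + Z t (m+1)
      Acc-det (suc (suc m)) le =
        DX.trans (DX.col-op n' (Acc (suc m)) (Acc (suc (suc m))) k (shP 1 1P) hoff hon) (Acc-det (suc m) (<⇒≤ le))
        where
        m<n' : m < n'
        m<n' = <-≤-trans (s≤s (ℕP.n≤1+n m)) le
        k : Fin n'
        k = fromℕ< m<n'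
        tk : toℕ k ≡ m
        tk = toℕ-fromℕ< m<n'
        tsk : toℕ (suc k) ≢ n'
        tsk e = <-irrefl (≡-trans (cong suc (≡-sym tk)) e) le
        tik : toℕ (inject₁ k) ≢ n'
        tik e = <-irrefl (≡-trans (≡-sym (≡-trans (toℕ-inject₁ k) tk)) e) m<n'
        hoff : ∀ t u → u ≢ suc k → Acc (suc (suc m)) t u ≈P Acc (suc m) t u
        hoff t u ne with toℕ u ≟ n'
        ... | yes e = ≋→≈P (≋-trans (≋-reflexive (Acc-last (suc (suc m)) t u e))
                                    (≋-reflexive (≡-sym (Acc-last (suc m) t u e))))
        ... | no nl with suc (toℕ u) ≤? suc m
        ...   | yes lt = ≋→≈P (≋-trans (≋-reflexive (Acc-done (suc (suc m)) t u nl (ℕP.m≤n⇒m≤1+n lt)))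
                                       (≋-reflexive (≡-sym (Acc-done (suc m) t u nl lt))))
        ...   | no nlt = ≋→≈P (≋-trans (≋-reflexive (Acc-todo (suc (suc m)) t u nl nlt'))
                                       (≋-reflexive (≡-sym (Acc-todo (suc m) t u nl nlt))))
          where
          nlt' : ¬ (toℕ u < suc (suc m))
          nlt' lt2 with ℕP.m≤n⇒m<n∨m≡n (ℕP.≤-pred lt2)
          ... | Data.Sum.inj₁ lt = nlt lt
          ... | Data.Sum.inj₂ e = ne (toℕ-injective (≡-trans e (≡-sym (cong suc tk))))
        hon : ∀ t → Acc (suc (suc m)) t (suc k) ≈P (Acc (suc m) t (suc k) +P (shP 1 1P *P Acc (suc m) t (inject₁ k)))
        hon t = ≋→≈P (PR.begin
            Acc (suc (suc m)) t (suc k)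
              PR.≈⟨ ≋-reflexive (Acc-done (suc (suc m)) t (suc k) tsk (s≤s (≤-reflexive (cong suc tk)))) ⟩
            rowHead (suc (suc (toℕ k))) t
              PR.≈⟨ ≋-reflexive (cong (λ x → rowHead (suc (suc x)) t) tk) ⟩
            (Z (toℕ t) (suc m) ∷ []) +P (0# ∷ rowHead (suc m) t)
              PR.≈⟨ ≋-sym (+P-cong entry-eq shift-eq) ⟩
            Acc (suc m) t (suc k) +P (shP 1 1P *P Acc (suc m) t (inject₁ k))
              PR.∎)
          where
          entry-eq : Acc (suc m) t (suc k) ≋ (Z (toℕ t) (suc m) ∷ [])
          entry-eq = ≋-trans (≋-reflexive (Acc-todo (suc m) t (suc k) tsk (λ lt → <-irrefl (cong suc tk) lt)))
                             (≋-reflexive (cong (λ x → Z (toℕ t) (suc x) ∷ []) tk))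
          k≡m : toℕ (inject₁ k) ≡ m
          k≡m = ≡-trans (toℕ-inject₁ k) tk
          shift-eq : (shP 1 1P *P Acc (suc m) t (inject₁ k)) ≋ (0# ∷ rowHead (suc m) t)
          shift-eq = ≋-trans (*P-congʳ (shP 1 1P) (≋-trans (≋-reflexive (Acc-done (suc m) t (inject₁ k) tik (s≤s (≤-reflexive k≡m))))
                                                            (≋-reflexive (cong (λ x → rowHead (suc x) t) k≡m))))
                             (x*P _)

      last-or-zero : ∀ n → (n ≡ 0) Data.Sum.⊎ Σ (Fin n) λ k → suc (toℕ k) ≡ n
      last-or-zero zero = Data.Sum.inj₁ ≡-refl
      last-or-zero (suc n) = Data.Sum.inj₂ (fromℕ n , cong suc (toℕ-fromℕ n))

      rowPoly : Fin (suc n') → Poly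
      rowPoly t = truncRow (suc i) t +P shP (suc i) (rowHead n' t)

      Row : Fin (suc n') → Fin (suc n') → Poly
      Row t u = if does (toℕ u ≟ n') then rowPoly t else Acc n' t u

      Row-last : ∀ t u → toℕ u ≡ n' → Row t u ≡ rowPoly t
      Row-last t u e rewrite ≡ᵇ-true e = ≡-refl
      Row-other : ∀ t u → toℕ u ≢ n' → Row t u ≡ Acc n' t u
      Row-other t u ne rewrite ≡ᵇ-false ne = ≡-refl

      Row-det : DX.det (suc n') Row ≈P DX.det (suc n') (Acc n')
      Row-det with last-or-zero n'
      ... | Data.Sum.inj₁ e = DX.det-cong (suc n') λ t u → ≋→≈P (pt t u)
        where
        pt : ∀ t u → Row t u ≋ Acc n' t u
        pt t u with toℕ u ≟ n'
        ... | yes el = PR.begin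
            Row t u                                       PR.≈⟨ ≋-reflexive (Row-last t u el) ⟩
            truncRow (suc i) t +P shP (suc i) (rowHead n' t) PR.≈⟨ +P-cong (≋-refl {truncRow (suc i) t}) noHead ⟩
            truncRow (suc i) t +P []                      PR.≈⟨ +P-idʳ _ ⟩
            truncRow (suc i) t                            PR.≈⟨ ≋-reflexive (≡-sym (Acc-last n' t u el)) ⟩
            Acc n' t u                                    PR.∎
          where
          noHead : shP (suc i) (rowHead n' t) ≋ []
          noHead = ≋-trans (sh-cong (suc i) (≋-reflexive (cong (λ x → rowHead x t) e))) (sh-[] (suc i))
        ... | no ne = ≋-reflexive (Row-other t u ne)
      ... | Data.Sum.inj₂ (k , e) = DX.col-op n' (Acc n') Row k (shP (suc i) 1P) hoff hon
        where
        hoff : ∀ t u → u ≢ suc k → Row t u ≈P Acc n' t u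
        hoff t u ne = ≋→≈P (≋-reflexive (Row-other t u (λ el → ne (toℕ-injective (≡-trans el (≡-sym e))))))
        tik : toℕ (inject₁ k) ≢ n'
        tik el = <-irrefl (≡-trans (≡-sym (toℕ-inject₁ k)) el) (ℕP.≤-reflexive e)
        hon : ∀ t → Row t (suc k) ≈P (Acc n' t (suc k) +P (shP (suc i) 1P *P Acc n' t (inject₁ k)))
        hon t = ≋→≈P (≋-trans (≋-reflexive (Row-last t (suc k) e))
                  (+P-cong (≋-reflexive (≡-sym (Acc-last n' t (suc k) e))) (≋-sym shift-eq)))
          where
          column : Acc n' t (inject₁ k) ≋ rowHead (suc (toℕ k)) t
          column = ≋-trans (≋-reflexive (Acc-done n' t (inject₁ k) tik
                             (<-≤-trans (s≤s (ℕP.≤-reflexive (toℕ-inject₁ k))) (ℕP.≤-reflexive e))))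
                           (≋-reflexive (cong (λ x → rowHead (suc x) t) (toℕ-inject₁ k)))
          shift-eq : (shP (suc i) 1P *P Acc n' t (inject₁ k)) ≋ shP (suc i) (rowHead n' t)
          shift-eq = ≋-trans (*P-congʳ (shP (suc i) 1P) column)
                       (≋-trans (sh-*ˡ (suc i) 1P (rowHead (suc (toℕ k)) t))
                         (sh-cong (suc i) (≋-trans (*P-idˡ (rowHead (suc (toℕ k)) t))
                                                    (≋-reflexive (cong (λ x → rowHead x t) e)))))

      rowHead-coeff : ∀ m t k → k < m → coeff (rowHead m t) k ≈ Z (toℕ t) (m ∸ suc k)
      rowHead-coeff (suc m) t zero lt = +-identityʳ (Z (toℕ t) m)
      rowHead-coeff (suc m) t (suc k) (s≤s lt) = rowHead-coeff m t k lt

      rowHead-above : ∀ m t k → m ≤ k → coeff (rowHead m t) k ≈ 0#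
      rowHead-above zero t k _ = refl
      rowHead-above (suc m) t (suc k) (s≤s le) = rowHead-above m t k le

      arith1 : ∀ j → (n' +ℕ i) ∸ (suc i +ℕ j) ≡ n' ∸ suc j
      arith1 j = ≡-trans (cong₂ _∸_ (ℕP.+-comm n' i) (≡-sym (ℕP.+-suc i j))) (ℕP.[m+n]∸[m+o]≡n∸o i n' (suc j))
        where open Eq using (cong₂)

      arith2 : ∀ j → suc i +ℕ j ≤ n' +ℕ i → suc j ≤ n'
      arith2 j le = ℕP.+-cancelˡ-≤ i (suc j) n' (ℕP.≤-trans (ℕP.≤-reflexive (ℕP.+-suc i j)) (ℕP.≤-trans le (ℕP.≤-reflexive (ℕP.+-comm n' i))))

      rowPoly-coeff : ∀ t k → k ≤ E → coeff (rowPoly t) k ≈ Z (toℕ t) (E ∸ k)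
      rowPoly-coeff t k le with suc k ≤? suc i
      ... | yes lt = begin
          coeff (rowPoly t) k                                              ≈⟨ coeff-+ (truncRow (suc i) t) (shP (suc i) (rowHead n' t)) k ⟩
          coeff (truncRow (suc i) t) k + coeff (shP (suc i) (rowHead n' t)) k ≈⟨ +-cong (coeff-tab-lo (λ j → Z (toℕ t) (E ∸ j)) (suc i) k lt)
                                                                                         (coeff-sh-lo (suc i) (rowHead n' t) k lt) ⟩
          Z (toℕ t) (E ∸ k) + 0#                                           ≈⟨ +-identityʳ _ ⟩
          Z (toℕ t) (E ∸ k)                                                ∎
      ... | no nlt with ≤-split (ℕP.≤-pred (≰⇒> nlt))
      ...   | j , ≡-refl = begin
          coeff (rowPoly t) (suc i +ℕ j)                   ≈⟨ coeff-+ (truncRow (suc i) t) (shP (suc i) (rowHead n' t)) (suc i +ℕ j) ⟩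
          coeff (truncRow (suc i) t) (suc i +ℕ j) + coeff (shP (suc i) (rowHead n' t)) (suc i +ℕ j)
                                                           ≈⟨ +-cong (coeff-tab-hi (λ j → Z (toℕ t) (E ∸ j)) (suc i) (suc i +ℕ j) (m≤m+n (suc i) j))
                                                                     (reflexive (coeff-sh-hi (suc i) (rowHead n' t) j)) ⟩
          0# + coeff (rowHead n' t) j                      ≈⟨ +-identityˡ _ ⟩
          coeff (rowHead n' t) j                           ≈⟨ rowHead-coeff n' t j (arith2 j le) ⟩
          Z (toℕ t) (n' ∸ suc j)                           ≈⟨ reflexive (cong (Z (toℕ t)) (≡-sym (arith1 j))) ⟩
          Z (toℕ t) (E ∸ (suc i +ℕ j))                     ∎

      rowPoly-above : ∀ t k → E < k → coeff (rowPoly t) k ≈ 0#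
      rowPoly-above t k lt with ≤-split (ℕP.≤-trans (s≤s (ℕP.m≤n+m i n')) lt)
      ... | j , ≡-refl = trans (coeff-+ (truncRow (suc i) t) (shP (suc i) (rowHead n' t)) (suc i +ℕ j))
                (trans (+-cong (coeff-tab-hi (λ j → Z (toℕ t) (E ∸ j)) (suc i) (suc i +ℕ j) (m≤m+n (suc i) j))
                               (trans (reflexive (coeff-sh-hi (suc i) (rowHead n' t) j)) (rowHead-above n' t j jge)))
                       (+-identityʳ 0#))
        where
        jge : n' ≤ j
        jge = ℕP.≮⇒≥ (λ jlt → ℕP.<-irrefl ≡-refl (ℕP.<-≤-trans lt (ℕP.≤-trans (ℕP.≤-reflexive (≡-sym (ℕP.+-suc i j)))
                                        (ℕP.≤-trans (ℕP.+-monoʳ-≤ i jlt) (ℕP.≤-reflexive (ℕP.+-comm i n'))))))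

      IsRowPoly : Fin (suc n') → Poly → Set ℓ
      IsRowPoly t P = (∀ k → k ≤ E → coeff P k ≈ Z (toℕ t) (E ∸ k)) × (∀ k → E < k → coeff P k ≈ 0#)

      rowPoly-unique : ∀ t {P} → IsRowPoly t P → rowPoly t ≋ P
      rowPoly-unique t {P} (low , high) = mk λ k → compare k
        where
        compare : ∀ k → coeff (rowPoly t) k ≈ coeff P k
        compare k with k ≤? E
        ... | yes k≤E = trans (rowPoly-coeff t k k≤E) (sym (low k k≤E))
        ... | no k≰E = trans (rowPoly-above t k (≰⇒> k≰E)) (sym (high k (≰⇒> k≰E)))

      -- the result: a common divisor H of row polynomials of all rows divides
      -- Σ_{j ≤ i} coeffDet j x^j, since H factors out of the last column of Row
      divides-coeffs : (H : Poly) → (∀ t → Σ Poly λ P → (H ∣≋ P) × IsRowPoly t P) →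
        H ∣≋ applyUpTo coeffDet (suc i)
      divides-coeffs H rows = DX.det (suc n') (DX.upd Row last W) , ≋-sym (PR.begin
          applyUpTo coeffDet (suc i)                PR.≈⟨ ≋-sym (Trunc-det (suc i)) ⟩
          DX.det (suc n') (Trunc (suc i))           PR.≈⟨ ≈P→≋ (DX.sym (Acc-det n' ℕP.≤-refl)) ⟩
          DX.det (suc n') (Acc n')                  PR.≈⟨ ≈P→≋ (DX.sym Row-det) ⟩
          DX.det (suc n') Row                       PR.≈⟨ ≈P→≋ (DX.factor-col (suc n') Row last H W lastCol-factor) ⟩
          H *P DX.det (suc n') (DX.upd Row last W)  PR.∎)
        where
        W : Fin (suc n') → Poly
        W t = proj₁ (proj₁ (proj₂ (rows t)))
        lastCol-factor : ∀ t → Row t last ≈P (H *P W t)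
        lastCol-factor t = ≋→≈P (PR.begin
          Row t last      PR.≈⟨ ≋-reflexive (Row-last t last tl) ⟩
          rowPoly t       PR.≈⟨ rowPoly-unique t (proj₂ (proj₂ (rows t))) ⟩
          proj₁ (rows t)  PR.≈⟨ ≋-sym (proj₂ (proj₁ (proj₂ (rows t)))) ⟩
          H *P W t        PR.∎)

-- A common divisor of f and g divides every subresultant Sᵢ(f, g), 1 ≤ i: the
-- coefficients s_ij are the determinants coeffDet j of BorderedDeterminant for the
-- Sylvester matrix, whose row polynomials are the shifts x^e · f and x^e · g.
module SubresultantDivisibility where

  open PolynomialArithmetic
  open PolynomialRings
  open RingHomomorphisms
  open Determinants
  open ShiftsAndRows
  open BorderedDeterminant
  open import Algebra.Bundles using (CommutativeRing)
  open import Data.Nat using (ℕ; zero; suc; _∸_) renaming (_+_ to _+ℕ_)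
  import Data.Nat as ℕ
  open import Data.Nat using (_≤_; _<_; _≤?_; s≤s)
  open import Data.Nat.Properties using (_≟_; ≤-trans; ≰⇒>; <-≤-trans; ≤-reflexive)
  import Data.Nat.Properties as ℕP
  open import Data.Nat.Tactic.RingSolver using (solve-∀)
  open import Data.Fin using (toℕ)
  open import Data.Fin.Properties using (toℕ<n)
  open import Data.List using (map; applyUpTo; upTo)
  open import Data.Bool using (true; false; if_then_else_; T)
  open import Data.List.Properties using (length-map; length-upTo)
  open import Data.Product using (Σ; _×_; _,_; proj₁; proj₂)
  open import Data.Empty using (⊥-elim)
  open import Relation.Nullary using (yes; no; does)
  open import Relation.Binary.PropositionalEquality as Eq using (_≡_; _≢_; cong) renaming (refl to ≡-refl; sym to ≡-sym; trans to ≡-trans)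
  open import Function using (_∘_; id)

  private
    sol1 : ∀ d s i A → d +ℕ (s +ℕ (i +ℕ A)) ≡ A +ℕ (s +ℕ d) +ℕ i
    sol1 = solve-∀
    sol2 : ∀ d s i B → d +ℕ (s +ℕ (i +ℕ B)) ≡ s +ℕ d +ℕ B +ℕ i
    sol2 = solve-∀
    sol3 : ∀ i a b → i +ℕ a +ℕ (i +ℕ b) ≡ i +ℕ (a +ℕ b +ℕ i)
    sol3 = solve-∀

  fRow-width : ∀ A s d i n' → A +ℕ (suc s +ℕ d) ≡ suc n' → d +ℕ (s +ℕ (i +ℕ A)) ≡ n' +ℕ i
  fRow-width A s d i n' h with ℕP.suc-injective (≡-trans (≡-sym (ℕP.+-suc A (s +ℕ d))) h)
  ... | ≡-refl = sol1 d s i A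

  gRow-width : ∀ B s d i n' → suc s +ℕ d +ℕ B ≡ suc n' → d +ℕ (s +ℕ (i +ℕ B)) ≡ n' +ℕ i
  gRow-width B s d i n' h with ℕP.suc-injective h
  ... | ≡-refl = sol2 d s i B

  -- the column p + q - i - j - 1 of Defs.sresCoeff (1-based: p + q - i - j) is E - j
  lastColumn-index : ∀ i a b n' j → a +ℕ b ≡ suc n' → (i +ℕ a +ℕ (i +ℕ b)) ∸ i ∸ j ∸ 1 ≡ (n' +ℕ i) ∸ j
  lastColumn-index i a b n' j h rewrite sol3 i a b | ℕP.m+n∸m≡n i (a +ℕ b +ℕ i) | h | ℕP.∸-+-assoc (suc (n' +ℕ i)) j 1 | ℕP.+-comm j 1 = ≡-refl

  nonzero⇒suc : ∀ x → x ≢ 0 → Σ ℕ λ n' → x ≡ suc n'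
  nonzero⇒suc zero ne = ⊥-elim (ne ≡-refl)
  nonzero⇒suc (suc x) _ = x , ≡-refl

  module SubresDiv {c ℓ} (R : CommutativeRing c ℓ) where
    open Divisibility R
    open Bordered R

    Zs : ℕ → ℕ → Poly → Poly → ℕ → ℕ → ℕ → Carrier
    Zs p q f g i t c0 = if does (suc t ≤? q ∸ i) then sylRow p f t c0 else sylRow q g (t ∸ (q ∸ i)) c0

    colF : ℕ → ℕ → ℕ → ℕ → ℕ → ℕ → ℕ
    colF p q i n j u = if does (u ≟ n ∸ 1) then (p +ℕ q) ∸ i ∸ j ∸ 1 else u

    shiftIsRow : ∀ n' i (Z : ℕ → ℕ → Carrier) t p f s e → Deg≤ f p → e +ℕ (s +ℕ p) ≡ n' +ℕ i →
      (∀ c0 → Z (toℕ t) c0 ≡ sylRow p f s c0) → Expansion.IsRowPoly n' i Z t (shP e f)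
    shiftIsRow n' i Z t p f s e degf width row = low , high
      where
      low : ∀ k → k ≤ n' +ℕ i → coeff (shP e f) k ≈ Z (toℕ t) ((n' +ℕ i) ∸ k)
      low k k≤E = trans (shiftedRow p f s e degf k (≤-trans k≤E (≤-reflexive (≡-sym width))))
                    (reflexive (≡-trans (cong (λ x → sylRow p f s (x ∸ k)) width) (≡-sym (row ((n' +ℕ i) ∸ k)))))
      high : ∀ k → n' +ℕ i < k → coeff (shP e f) k ≈ 0#
      high k E<k = shiftedRow-above p f s e degf k (<-≤-trans (s≤s (≤-reflexive width)) E<k)

    tab-cong : ∀ (a b : ℕ → Carrier) m → (∀ j → a j ≈ b j) → applyUpTo a m ≋ applyUpTo b m
    tab-cong a b zero h = ≋-refl
    tab-cong a b (suc m) h = cons-cong (h zero) (tab-cong (a ∘ suc) (b ∘ suc) m (h ∘ suc))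

    sresGeneral-divisible : ∀ p q f g i H (n' : ℕ) → (p ∸ i) +ℕ (q ∸ i) ≡ suc n' → i ≤ p → i ≤ q →
      Deg≤ f p → Deg≤ g q → H ∣≋ f → H ∣≋ g → H ∣≋ map (sresCoeff p q f g i) (upTo (suc i))
    sresGeneral-divisible p q f g i H n' hAB ip iq dgf dgg Hf Hg =
      ∣-cong {H} (≋-sym (≋-trans (≋-reflexive (map-applyUpTo (sresCoeff p q f g i) id (suc i))) (tab-cong _ _ (suc i) (λ j → sresCoeff-det _ hAB j))))
        (divides-coeffs H rows)
      where
      open Expansion n' i (Zs p q f g i)
      A = p ∸ i
      B = q ∸ i
      hA : p ≡ i +ℕ A
      hA = ≡-sym (ℕP.m+[n∸m]≡n ip)
      hB : q ≡ i +ℕ B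
      hB = ≡-sym (ℕP.m+[n∸m]≡n iq)
      arith : ∀ j → (p +ℕ q) ∸ i ∸ j ∸ 1 ≡ (n' +ℕ i) ∸ j
      arith j = ≡-trans (cong (λ x → x ∸ i ∸ j ∸ 1) (Eq.cong₂ _+ℕ_ hA hB)) (lastColumn-index i A B n' j hAB)
      colEq : ∀ j u → colF p q i (suc n') j u ≡ lastCol j u
      colEq j u with u Data.Nat.≡ᵇ n'
      ... | true = arith j
      ... | false = ≡-refl
      sresCoeff-det : ∀ n → n ≡ suc n' → ∀ j → D0.det n (λ t u → Zs p q f g i (toℕ t) (colF p q i n j (toℕ u))) ≈ coeffDet j
      sresCoeff-det .(suc n') ≡-refl j = D0.det-cong (suc n') λ t u → reflexive (cong (Zs p q f g i (toℕ t)) (colEq j (toℕ u)))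
      rows : ∀ t → Σ Poly λ P → (H ∣≋ P) × IsRowPoly t P
      rows t with suc (toℕ t) ≤? B
      ... | yes lt with ≤-split lt
      ...   | d , eB = shP e f , ∣-sh {H} {f} e Hf , shiftIsRow n' i (Zs p q f g i) t p f s e dgf Eeq Zf
        where
        s = toℕ t
        e = B ∸ suc s
        ee : e ≡ d
        ee = ≡-trans (cong (_∸ suc s) eB) (ℕP.m+n∸m≡n (suc s) d)
        Eeq : e +ℕ (s +ℕ p) ≡ E
        Eeq = ≡-trans (Eq.cong₂ (λ x y → x +ℕ (s +ℕ y)) ee hA) (fRow-width A s d i n' (≡-trans (cong (A +ℕ_) (≡-sym eB)) hAB))
        Zf : ∀ c0 → Zs p q f g i s c0 ≡ sylRow p f s c0
        Zf c0 rewrite ≤ᵇ-true lt = ≡-refl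
      rows t | no nlt with ≤-split (ℕP.≤-pred (≰⇒> nlt))
      ...   | s , et = shP e g , ∣-sh {H} {g} e Hg , shiftIsRow n' i (Zs p q f g i) t q g s e dgg Eeq Zg
        where
        slt : suc s ≤ A
        slt = ℕP.+-cancelʳ-≤ B (suc s) A (ℕP.≤-trans (ℕP.≤-reflexive (cong suc (ℕP.+-comm s B)))
                (ℕP.≤-trans (ℕP.≤-reflexive (≡-sym (cong suc et))) (ℕP.≤-trans (toℕ<n t) (ℕP.≤-reflexive (≡-sym hAB)))))
        d = proj₁ (≤-split slt)
        eA : A ≡ suc s +ℕ d
        eA = proj₂ (≤-split slt)
        e = A ∸ suc s
        ee : e ≡ d
        ee = ≡-trans (cong (_∸ suc s) eA) (ℕP.m+n∸m≡n (suc s) d)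
        Eeq : e +ℕ (s +ℕ q) ≡ E
        Eeq = ≡-trans (Eq.cong₂ (λ x y → x +ℕ (s +ℕ y)) ee hB) (gRow-width B s d i n' (≡-trans (cong (_+ℕ B) (≡-sym eA)) hAB))
        Zg : ∀ c0 → Zs p q f g i (toℕ t) c0 ≡ sylRow q g s c0
        Zg c0 rewrite ≤ᵇ-false nlt | et = cong (λ x → sylRow q g x c0) (ℕP.m+n∸m≡n B s)

    sresDiv : ∀ p q f g i H → i ≤ p → i ≤ q → 1 ≤ i → Deg≤ f p → Deg≤ g q → H ∣≋ f → H ∣≋ g → H ∣≋ sres p q f g i
    sresDiv p q f g i H ip iq i1 dgf dgg Hf Hg with p ≟ q
    ... | yes p≡q rewrite ≡ᵇ-true p≡q | ≡ᵇ-false {q} {0} (λ e → ℕP.<-irrefl (≡-sym e) (ℕP.<-≤-trans i1 iq)) with i ≟ q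
    ...   | yes i≡q rewrite ≡ᵇ-true i≡q = Hg
    ...   | no i≢q rewrite ≡ᵇ-false i≢q = gen λ e → i≢q (≡-sym (ℕP.≤-antisym (iq' e) iq))
      where
      iq' : (p ∸ i) +ℕ (q ∸ i) ≡ 0 → q ≤ i
      iq' e = ℕP.m∸n≡0⇒m≤n (ℕP.m+n≡0⇒n≡0 (p ∸ i) e)
      gen : (p ∸ i) +ℕ (q ∸ i) ≢ 0 → H ∣≋ map (sresCoeff p q f g i) (upTo (suc i))
      gen ne = sresGeneral-divisible p q f g i H (proj₁ (nonzero⇒suc _ ne)) (proj₂ (nonzero⇒suc _ ne)) ip iq dgf dgg Hf Hg
    sresDiv p q f g i H ip iq i1 dgf dgg Hf Hg | no p≢q rewrite ≡ᵇ-false p≢q = gen λ e →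
        p≢q (≡-trans (ℕP.≤-antisym (ℕP.m∸n≡0⇒m≤n (ℕP.m+n≡0⇒m≡0 (p ∸ i) e)) ip) (≡-sym (ℕP.≤-antisym (ℕP.m∸n≡0⇒m≤n (ℕP.m+n≡0⇒n≡0 (p ∸ i) e)) iq)))
      where
      gen : (p ∸ i) +ℕ (q ∸ i) ≢ 0 → H ∣≋ map (sresCoeff p q f g i) (upTo (suc i))
      gen ne = sresGeneral-divisible p q f g i H (proj₁ (nonzero⇒suc _ ne)) (proj₂ (nonzero⇒suc _ ne)) ip iq dgf dgg Hf Hg

    sresGeneral-deg : ∀ p q f g i → Deg≤ (map (sresCoeff p q f g i) (upTo (suc i))) i
    sresGeneral-deg p q f g i k lt = coeff-len _ k (ℕP.≤-trans (ℕP.≤-reflexive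
      (≡-trans (length-map _ (upTo (suc i))) (length-upTo (suc i)))) lt)

    sresDeg : ∀ p q f g i → Deg≤ g q → Deg≤ (sres p q f g i) i
    sresDeg p q f g i dg with p ℕ.≡ᵇ q | q ℕ.≡ᵇ 0 | i ℕ.≡ᵇ q in i≡ᵇq
    ... | false | _     | _     = sresGeneral-deg p q f g i
    ... | true  | true  | _     = λ { zero () ; (suc k) _ → refl }
    ... | true  | false | true  = λ k lt → dg k (ℕP.<-≤-trans (ℕP.≤-reflexive (cong suc (≡-sym i≡q))) lt)
      where
      i≡q : i ≡ q
      i≡q = ℕP.≡ᵇ⇒≡ i q (Eq.subst T (≡-sym i≡ᵇq) _)
    ... | true  | false | false = sresGeneral-deg p q f g i

-- Subresultants are built from the coefficients by determinants and case
-- distinctions only, so ring homomorphisms commute with them.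
module SubresultantImage where

  open PolynomialArithmetic
  open PolynomialRings
  open RingHomomorphisms
  open Determinants
  open ShiftsAndRows
  open import Algebra.Bundles using (CommutativeRing)
  open import Data.Nat using (ℕ; suc; _∸_) renaming (_+_ to _+ℕ_)
  import Data.Nat as ℕ
  import Data.Nat.Properties
  open import Data.Fin using (Fin; toℕ)
  open import Data.List using (List; []; _∷_; map; upTo)
  open import Data.Bool using (Bool; true; false; if_then_else_; _∧_)
  open import Relation.Nullary using (does)

  module SubresHom {a ℓa b ℓb} {R : CommutativeRing a ℓa} {S : CommutativeRing b ℓb} {h} (H : IsHom R S h) where
    private
      module R = Divisibility R
      module S = Divisibility S
      module D = DetHom H

    ifHom : ∀ (bb : Bool) x y → h (if bb then x else y) S.≈ (if bb then h x else h y)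
    ifHom true x y = S.refl
    ifHom false x y = S.refl

    ifCong : ∀ (bb : Bool) {x y x' y'} → x S.≈ x' → y S.≈ y' → (if bb then x else y) S.≈ (if bb then x' else y')
    ifCong true e1 e2 = e1
    ifCong false e1 e2 = e2

    sylHom : ∀ p f s c0 → h (R.sylRow p f s c0) S.≈ S.sylRow p (map h f) s c0
    sylHom p f s c0 = S.trans (ifHom _ _ _) (ifCong ((s ℕ.≤ᵇ c0) ∧ ((c0 ∸ s) ℕ.≤ᵇ p)) (S.sym (coeff-map H f (p ∸ (c0 ∸ s)))) (h-0 H))

    coeffHom : ∀ p q f g i j → h (R.sresCoeff p q f g i j) S.≈ S.sresCoeff p q (map h f) (map h g) i j
    coeffHom p q f g i j = S.trans (D.det-hom n (M R.sylRow f g)) (DetLaws.det-cong S n λ t u →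
      S.trans (ifHom (suc (toℕ t) ℕ.≤ᵇ q ∸ i) _ _) (ifCong (suc (toℕ t) ℕ.≤ᵇ q ∸ i) (sylHom p f (toℕ t) (col u)) (sylHom q g (toℕ t ∸ (q ∸ i)) (col u))))
      where
      n = (p ∸ i) +ℕ (q ∸ i)
      col : Fin n → ℕ
      col u = if does (toℕ u Data.Nat.Properties.≟ n ∸ 1) then (p +ℕ q) ∸ i ∸ j ∸ 1 else toℕ u
      M : ∀ {C : Set a} → (ℕ → List C → ℕ → ℕ → C) → List C → List C → Fin n → Fin n → C
      M sr f' g' t u = if does (suc (toℕ t) ℕ.≤? q ∸ i) then sr p f' (toℕ t) (col u) else sr q g' (toℕ t ∸ (q ∸ i)) (col u)

    map-pointwise : ∀ (F : ℕ → R.Carrier) (G : ℕ → S.Carrier) xs → (∀ x → h (F x) S.≈ G x) →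
      map h (map F xs) S.≋ map G xs
    map-pointwise F G [] e = S.≋-refl
    map-pointwise F G (x ∷ xs) e = S.cons-cong (e x) (map-pointwise F G xs e)

    sresHom : ∀ p q f g i → map h (R.sres p q f g i) S.≋ S.sres p q (map h f) (map h g) i
    sresHom p q f g i with p ℕ.≡ᵇ q | q ℕ.≡ᵇ 0 | i ℕ.≡ᵇ q
    ... | false | _ | _ = map-pointwise _ _ (upTo (suc i)) (coeffHom p q f g i)
    ... | true | true | _ = S.cons-cong (h-1 H) S.≋-refl
    ... | true | false | true = S.≋-refl
    ... | true | false | false = map-pointwise _ _ (upTo (suc i)) (coeffHom p q f g i)

module LinearFactors where

  open PolynomialArithmetic
  open PolynomialRings
  open RingHomomorphisms
  open ShiftsAndRows
  open import Level using (_⊔_)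
  open import Algebra.Bundles using (CommutativeRing)
  open import Data.Nat using (zero; suc) renaming (_+_ to _+ℕ_)
  open import Data.Nat using (_≤_; z≤n; s≤s)
  import Data.Nat.Properties as ℕP
  open import Data.List using ([]; _∷_; length)
  open import Data.Product using (Σ; _×_; _,_; proj₁; proj₂)
  open import Relation.Nullary using (yes; no)
  open import Relation.Binary.PropositionalEquality as Eq using (cong) renaming (refl to ≡-refl; sym to ≡-sym; trans to ≡-trans)

  module LinearFactorLaws {c ℓ} (R : CommutativeRing c ℓ) where
    open Divisibility R public

    top-coeff : ∀ H W a b → Deg≤ H a → Deg≤ W b → (coeff (H *P W) (a +ℕ b) ≈ coeff H a * coeff W b) × Deg≤ (H *P W) (a +ℕ b)
    top-coeff [] W a b dH dW = sym (zeroˡ _) , λ k _ → refl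
    top-coeff (h ∷ H') W zero b dH dW = c1 , d1
      where
      H'0 : H' ≋ []
      H'0 = mk λ k → dH (suc k) (s≤s z≤n)
      z : (H' *P W) ≋ []
      z = *P-zeroˡ H' W H'0
      cf : ∀ k → coeff ((h ∷ H') *P W) k ≈ h * coeff W k
      cf k = trans (coeff-+ (scale h W) (0# ∷ (H' *P W)) k) (trans (+-cong (coeff-scale h W k) (at (cons-[] refl z) k)) (+-identityʳ _))
      c1 = cf b
      d1 : Deg≤ ((h ∷ H') *P W) b
      d1 k lt = trans (cf k) (trans (*-congˡ (dW k lt)) (zeroʳ h))
    top-coeff (h ∷ H') W (suc a) b dH dW = c1 , d1
      where
      ih = top-coeff H' W a b (λ k lt → dH (suc k) (s≤s lt)) dW
      c1 : coeff ((h ∷ H') *P W) (suc (a +ℕ b)) ≈ coeff H' a * coeff W b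
      c1 = trans (coeff-+ (scale h W) (0# ∷ (H' *P W)) (suc (a +ℕ b)))
             (trans (+-cong (trans (coeff-scale h W _) (trans (*-congˡ (dW _ (s≤s (ℕP.m≤n+m b a)))) (zeroʳ h))) (proj₁ ih)) (+-identityˡ _))
      d1 : Deg≤ ((h ∷ H') *P W) (suc (a +ℕ b))
      d1 (suc k) (s≤s lt) = trans (coeff-+ (scale h W) (0# ∷ (H' *P W)) (suc k))
             (trans (+-cong (trans (coeff-scale h W _) (trans (*-congˡ (dW _ (ℕP.≤-trans (s≤s (ℕP.m≤n+m b a)) (ℕP.<⇒≤ (s≤s lt))))) (zeroʳ h))) (proj₂ ih k lt)) (+-identityˡ 0#))

    Unit : Carrier → Set (c ⊔ ℓ)
    Unit u = Σ Carrier λ v → u * v ≈ 1#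

    unit-cancel : ∀ {u w} → Unit u → u * w ≈ 0# → w ≈ 0#
    unit-cancel {u} {w} (v , uv) e = begin
      w ≈⟨ sym (*-identityˡ w) ⟩
      1# * w ≈⟨ *-congʳ (sym uv) ⟩
      (u * v) * w ≈⟨ *-congʳ (*-comm u v) ⟩
      (v * u) * w ≈⟨ *-assoc v u w ⟩
      v * (u * w) ≈⟨ *-congˡ e ⟩
      v * 0# ≈⟨ zeroʳ v ⟩
      0# ∎

    Unit-resp : ∀ {x y} → x ≈ y → Unit x → Unit y
    Unit-resp x≈y (v , xv≈1) = v , trans (*-congʳ (sym x≈y)) xv≈1

    -- if the coefficient of H at deg H ≤ a is invertible, then deg (H W) ≤ a + e
    -- forces deg W ≤ e (a nonzero coefficient of W above e would survive in H W)
    quotDeg : ∀ H W a e → Deg≤ H a → Unit (coeff H a) → Deg≤ (H *P W) (a +ℕ e) → Deg≤ W e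
    quotDeg H W a e dH u dHW = go (length W) (λ k lt → degLen W k (ℕP.≤-<-trans (ℕP.m≤n+m (length W) e) lt))
      where
      go : ∀ m → Deg≤ W (e +ℕ m) → Deg≤ W e
      go zero d = λ k lt → d k (ℕP.≤-trans (s≤s (ℕP.≤-reflexive (ℕP.+-identityʳ e))) lt)
      go (suc m) d = go m d'
        where
        wz : coeff W (e +ℕ suc m) ≈ 0#
        wz = unit-cancel u (trans (sym (proj₁ (top-coeff H W a (e +ℕ suc m) dH d)))
                                 (dHW _ (ℕP.+-monoʳ-< a (ℕP.m<m+n e (s≤s z≤n)))))
        d' : Deg≤ W (e +ℕ m)
        d' k lt with k ℕP.≟ (e +ℕ suc m)
        ... | yes ≡-refl = wz
        ... | no ne = d k (ℕP.≤∧≢⇒< (ℕP.≤-trans (ℕP.≤-reflexive (ℕP.+-suc e m)) lt) (λ x → ne (≡-sym x)))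

    -- a multiple P of H with deg P ≤ deg H = δ, where the top coefficient of H is
    -- invertible, is a constant multiple of H: the cofactor has degree 0
    constantMultiple : ∀ H P δ → Deg≤ H δ → Unit (coeff H δ) → Deg≤ P δ → H ∣≋ P →
      Σ Carrier λ w → P ≋ scale w H
    constantMultiple H P δ dH u dP (W , HW≋P) = w , (PR.begin
        P               PR.≈⟨ ≋-sym HW≋P ⟩
        H *P W          PR.≈⟨ *P-congʳ H W≋w ⟩
        H *P (w ∷ [])   PR.≈⟨ *P-comm H (w ∷ []) ⟩
        (w ∷ []) *P H   PR.≈⟨ const-*P w H ⟩
        scale w H       PR.∎)
      where
      w : Carrier
      w = coeff W 0
      W-const : Deg≤ W 0
      W-const = quotDeg H W δ 0 dH u λ k lt →
        trans (at HW≋P k) (dP k (ℕP.≤-trans (s≤s (ℕP.≤-reflexive (≡-sym (ℕP.+-identityʳ δ)))) lt))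
      W≋w : W ≋ (w ∷ [])
      W≋w = mk λ { zero → refl ; (suc k) → W-const (suc k) (s≤s z≤n) }

    import Tactic.RingSolver.NonReflective
    open import Data.Maybe using (nothing)
    open import Tactic.RingSolver.Core.AlmostCommutativeRing using (fromCommutativeRing)
    private
      module NR = Tactic.RingSolver.NonReflective (fromCommutativeRing R (λ _ → nothing))
    open NR using (solve; _⊜_; _⊕_; _⊗_)

    eval-[] : ∀ {p} z → p ≋ [] → eval p z ≈ 0#
    eval-[] {[]} z e = refl
    eval-[] {a ∷ p} z e = trans (+-cong (at e zero) (trans (*-congˡ (eval-[] z (tail-[] e))) (zeroʳ z))) (+-identityʳ 0#)

    eval-cong : ∀ {p q} z → p ≋ q → eval p z ≈ eval q z
    eval-cong {[]} {q} z e = sym (eval-[] z (≋-sym e))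
    eval-cong {a ∷ p} {[]} z e = eval-[] z e
    eval-cong {a ∷ p} {b ∷ q} z e = +-cong (at e zero) (*-congˡ (eval-cong z (tail-≋ e)))

    eval-congʳ : ∀ p {z z'} → z ≈ z' → eval p z ≈ eval p z'
    eval-congʳ [] e = refl
    eval-congʳ (a ∷ p) e = +-congˡ (*-cong e (eval-congʳ p e))

    eval-+ : ∀ p q z → eval (p +P q) z ≈ eval p z + eval q z
    eval-+ [] q z = sym (+-identityˡ _)
    eval-+ (a ∷ p) [] z = sym (+-identityʳ _)
    eval-+ (a ∷ p) (b ∷ q) z = trans (+-congˡ (*-congˡ (eval-+ p q z)))
      (solve 5 (λ a b z x y → ((a ⊕ b) ⊕ (z ⊗ (x ⊕ y))) ⊜ ((a ⊕ (z ⊗ x)) ⊕ (b ⊕ (z ⊗ y)))) refl a b z (eval p z) (eval q z))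

    eval-scale : ∀ a p z → eval (scale a p) z ≈ a * eval p z
    eval-scale a [] z = sym (zeroʳ a)
    eval-scale a (b ∷ p) z = trans (+-congˡ (*-congˡ (eval-scale a p z)))
      (solve 4 (λ a b z x → ((a ⊗ b) ⊕ (z ⊗ (a ⊗ x))) ⊜ (a ⊗ (b ⊕ (z ⊗ x)))) refl a b z (eval p z))

    eval-* : ∀ p q z → eval (p *P q) z ≈ eval p z * eval q z
    eval-* [] q z = sym (zeroˡ _)
    eval-* (a ∷ p) q z = trans (eval-+ (scale a q) (0# ∷ (p *P q)) z)
      (trans (+-cong (eval-scale a q z) (trans (+-identityˡ _) (*-congˡ (eval-* p q z))))
        (solve 4 (λ a y z x → ((a ⊗ y) ⊕ (z ⊗ (x ⊗ y))) ⊜ ((a ⊕ (z ⊗ x)) ⊗ y)) refl a (eval q z) z (eval p z)))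

    eval-X- : ∀ b z → eval (X- b) z ≈ z + (- b)
    eval-X- b z = trans (+-congˡ (trans (*-congˡ (trans (+-congˡ (zeroʳ z)) (+-identityʳ 1#))) (*-identityʳ z))) (+-comm (- b) z)

    eval-X-b : ∀ b → eval (X- b) b ≈ 0#
    eval-X-b b = trans (eval-X- b b) (-‿inverseʳ b)

    -- synthetic division: p = (x - b) · q + p(b)
    sdiv : Carrier → Poly → Poly × Carrier
    sdiv b [] = [] , 0#
    sdiv b (a ∷ p) = (proj₂ (sdiv b p) ∷ proj₁ (sdiv b p)) , (a + b * proj₂ (sdiv b p))

    sdiv-eq : ∀ b p → p ≋ (((X- b) *P proj₁ (sdiv b p)) +P (proj₂ (sdiv b p) ∷ []))
    sdiv-eq b [] = ≋-sym (≋-trans (+P-cong (*P-[]ʳ (X- b)) ≋-refl) (cons-[] refl ≋-refl))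
    sdiv-eq b (a ∷ p) = ≋-trans (cons-cong hd tl) (≋-sym (+P-cong (*P-consʳ (X- b) r' Q') (≋-refl {(a + b * r') ∷ []})))
      where
      Q' = proj₁ (sdiv b p)
      r' = proj₂ (sdiv b p)
      hd : a ≈ ((r' * (- b) + 0#) + (a + b * r'))
      hd = sym (begin
        (r' * (- b) + 0#) + (a + b * r') ≈⟨ +-congʳ (trans (+-identityʳ _) (trans (sym (-‿distribʳ-* r' b)) (-‿cong (*-comm r' b)))) ⟩
        (- (b * r')) + (a + b * r') ≈⟨ +-congˡ (+-comm a (b * r')) ⟩
        (- (b * r')) + (b * r' + a) ≈⟨ sym (+-assoc _ _ _) ⟩
        ((- (b * r')) + b * r') + a ≈⟨ +-congʳ (-‿inverseˡ _) ⟩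
        0# + a ≈⟨ +-identityˡ a ⟩
        a ∎)
      tl : p ≋ (((r' * 1#) ∷ []) +P ((X- b) *P Q')) +P []
      tl = ≋-trans (sdiv-eq b p) (≋-trans (+P-comm ((X- b) *P Q') (r' ∷ []))
             (≋-trans (+P-cong (cons-cong (sym (*-identityʳ r')) (≋-refl {[]})) (≋-refl {(X- b) *P Q'}))
                      (≋-sym (+P-idʳ (((r' * 1#) ∷ []) +P ((X- b) *P Q'))))))

    sdiv-rem : ∀ b p → proj₂ (sdiv b p) ≈ eval p b
    sdiv-rem b [] = refl
    sdiv-rem b (a ∷ p) = +-congˡ (*-congˡ (sdiv-rem b p))

    factorThm : ∀ b p → eval p b ≈ 0# → (X- b) ∣≋ p
    factorThm b p e = proj₁ (sdiv b p) , ≋-sym (≋-trans (sdiv-eq b p) (≋-trans (+P-cong ≋-refl (cons-[] (trans (sdiv-rem b p) e) ≋-refl)) (+P-idʳ _)))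

    divEval : ∀ b p → (X- b) ∣≋ p → eval p b ≈ 0#
    divEval b p (W , w) = trans (sym (eval-cong b w)) (trans (eval-* (X- b) W b) (trans (*-congʳ (eval-X-b b)) (zeroˡ _)))

    coeffXb : ∀ b C k → coeff ((X- b) *P C) (suc k) ≈ coeff C k + (- b) * coeff C (suc k)
    coeffXb b C k = trans (coeff-+ (scale (- b) C) (0# ∷ ((1# ∷ []) *P C)) (suc k))
      (trans (+-cong (coeff-scale (- b) C (suc k)) (at (*P-idˡ C) k)) (+-comm _ _))

    -- (x - b) C = 0 forces C = 0, comparing coefficients from the top down
    Xb-zero : ∀ b C → ((X- b) *P C) ≋ [] → C ≋ []
    Xb-zero b C e = mk λ k → go (length C) k (ℕP.m≤n+m (length C) k)
      where
      go : ∀ m k → length C ≤ k +ℕ m → coeff C k ≈ 0#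
      go zero k le = coeff-len C k (ℕP.≤-trans le (ℕP.≤-reflexive (ℕP.+-identityʳ k)))
      go (suc m) k le = trans (sym (+-identityʳ _)) (trans (+-congˡ (sym (trans (*-congˡ ih) (zeroʳ _)))) (trans (sym (coeffXb b C k)) (at e (suc k))))
        where
        ih : coeff C (suc k) ≈ 0#
        ih = go m (suc k) (ℕP.≤-trans le (ℕP.≤-reflexive (ℕP.+-suc k m)))

    -P-scale : ∀ p → (-P p) ≋ scale (- 1#) p
    -P-scale p = mk λ k → trans (coeff-neg p k) (trans (sym (trans (sym (-‿distribˡ-* 1# _)) (-‿cong (*-identityˡ _)))) (sym (coeff-scale (- 1#) p k)))

    cancelXb : ∀ b A B → ((X- b) *P A) ≋ ((X- b) *P B) → A ≋ B
    cancelXb b A B e = ≋-trans (≋-sym (+P-idʳ A)) (≋-trans (+P-cong ≋-refl (≋-sym (-P-invˡ B)))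
        (≋-trans (≋-sym (+P-assoc A (-P B) B)) (≋-trans (+P-cong C0 ≋-refl) (+P-idˡ B))))
      where
      XC : ((X- b) *P (A +P (-P B))) ≋ []
      XC = ≋-trans (*P-distribˡ (X- b) A (-P B))
           (≋-trans (+P-cong e (≋-trans (*P-congʳ (X- b) (-P-scale B)) (≋-trans (scale-*ʳ (- 1#) (X- b) B) (≋-sym (-P-scale _)))))
             (-P-invʳ ((X- b) *P B)))
      C0 : (A +P (-P B)) ≋ []
      C0 = Xb-zero b _ XC

module Factorisation where

  open PolynomialArithmetic
  open PolynomialRings
  open RingHomomorphisms
  open ShiftsAndRows
  open LinearFactors
  open import Level using (_⊔_)
  open import Algebra.Bundles using (CommutativeRing)
  open import Data.Nat using (ℕ; zero; suc) renaming (_+_ to _+ℕ_)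
  open import Data.Nat using (z≤n; s≤s)
  open import Data.Fin using (Fin; zero; suc)
  open import Data.Fin.Properties using (suc-injective) renaming (_≟_ to _≟F_)
  open import Data.List using ([]; _∷_)
  open import Data.Product using (Σ; _×_; _,_; proj₁; proj₂)
  open import Data.Empty using (⊥-elim)
  open import Relation.Nullary using (¬_; yes; no; Dec)
  open import Relation.Binary.PropositionalEquality as Eq using (_≡_; _≢_; cong) renaming (refl to ≡-refl; sym to ≡-sym; trans to ≡-trans)
  open import Function using (_∘_)

  module Products {c ℓ} (R : CommutativeRing c ℓ) where
    open LinearFactorLaws R public

    prod-cong : ∀ d {v w : Fin d → Poly} → (∀ i → v i ≋ w i) → prodFinP d v ≋ prodFinP d w
    prod-cong zero h = ≋-refl
    prod-cong (suc d) h = *P-cong (h zero) (prod-cong d (h ∘ suc))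

    pow-cong : ∀ e {v w} → v ≋ w → (v ^P e) ≋ (w ^P e)
    pow-cong zero E = ≋-refl
    pow-cong (suc e) E = *P-cong E (pow-cong e E)

    prod-ones : ∀ d (v : Fin d → Poly) → (∀ i → v i ≋ 1P) → prodFinP d v ≋ 1P
    prod-ones zero v h = ≋-refl
    prod-ones (suc d) v h = ≋-trans (*P-cong (h zero) (prod-ones d (v ∘ suc) (h ∘ suc))) (*P-idˡ 1P)

    prod-update : ∀ d (v : Fin d → Poly) (e e' : Fin d → ℕ) (i : Fin d) → e i ≡ suc (e' i) → (∀ j → j ≢ i → e j ≡ e' j) →
      prodFinP d (λ j → v j ^P e j) ≋ (v i *P prodFinP d (λ j → v j ^P e' j))
    prod-update (suc d) v e e' zero ei eo =
      ≋-trans (*P-cong (≋-reflexive (cong (v zero ^P_) ei)) (prod-cong d (λ j → ≋-reflexive (cong (v (suc j) ^P_) (eo (suc j) (λ ()))))))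
              (*P-assoc (v zero) (v zero ^P e' zero) _)
    prod-update (suc d) v e e' (suc i) ei eo =
      ≋-trans (*P-cong (≋-reflexive (cong (v zero ^P_) (eo zero (λ ())))) (prod-update d (v ∘ suc) (e ∘ suc) (e' ∘ suc) i ei (λ j ne → eo (suc j) (ne ∘ suc-injective))))
      (≋-trans (≋-sym (*P-assoc (v zero ^P e' zero) (v (suc i)) _))
      (≋-trans (*P-congˡ _ (*P-comm (v zero ^P e' zero) (v (suc i))))
      (*P-assoc (v (suc i)) (v zero ^P e' zero) _)))

    pow-div : ∀ b k {H} → ((X- b) ^P suc k) ∣≋ H → (X- b) ∣≋ H
    pow-div b k {H} (W , w) = ((X- b) ^P k) *P W , ≋-trans (≋-sym (*P-assoc (X- b) ((X- b) ^P k) W)) w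

    pow-subst : ∀ v {a a' H} → a ≡ a' → (v ^P a) ∣≋ H → (v ^P a') ∣≋ H
    pow-subst v ≡-refl h = h

    X-deg : ∀ c → Deg≤ (X- c) 1
    X-deg c zero ()
    X-deg c (suc zero) (s≤s ())
    X-deg c (suc (suc k)) _ = refl

    linear-quotient : ∀ {H Q n} c → ((X- c) *P Q) ≋ H → HasDegree H (suc n) →
      HasDegree Q n × (coeff Q n ≈ coeff H (suc n))
    linear-quotient {H} {Q} {n} c XQ≋H (top≉0 , above) = ((λ z → top≉0 (trans (sym topQ) z)) , degQ) , topQ
      where
      degQ : Deg≤ Q n
      degQ = quotDeg (X- c) Q 1 n (X-deg c) (1# , *-identityʳ 1#) (λ k lt → trans (at XQ≋H k) (above k lt))
      topQ : coeff Q n ≈ coeff H (suc n)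
      topQ = trans (sym (*-identityˡ _))
               (trans (sym (proj₁ (top-coeff (X- c) Q 1 n (X-deg c) degQ))) (at XQ≋H (suc n)))

  module ClosedField {c ℓ} (R : CommutativeRing c ℓ) (isF : IsField R)
                     (alg : PolyOps.IsAlgClosed (CommutativeRing.rawRing R)) where
    open Products R public

    unitOf : ∀ {x} → ¬ (x ≈ 0#) → Unit x
    unitOf nz = proj₂ isF _ nz

    -- x - c is coprime to x - b for b ≠ c: evaluating at c, then induction on e
    coprime : ∀ e b c {Q} → ¬ (b ≈ c) → ((X- c) ^P e) ∣≋ ((X- b) *P Q) → ((X- c) ^P e) ∣≋ Q
    coprime zero b c {Q} ne _ = Q , *P-idˡ Q
    coprime (suc e) b c {Q} ne (W , w) =
      proj₁ ih , ≋-trans (*P-assoc (X- c) ((X- c) ^P e) (proj₁ ih)) (≋-trans (*P-congʳ (X- c) (proj₂ ih)) hQ')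
      where
      -- evaluating (x - b) Q = (x - c)^(e+1) W at c, where x - b does not vanish
      evQ : eval Q c ≈ 0#
      evQ = unit-cancel (unitOf nz) (begin
        eval (X- b) c * eval Q c                   ≈⟨ sym (eval-* (X- b) Q c) ⟩
        eval ((X- b) *P Q) c                       ≈⟨ sym (eval-cong c w) ⟩
        eval (((X- c) ^P suc e) *P W) c            ≈⟨ eval-* ((X- c) ^P suc e) W c ⟩
        eval ((X- c) ^P suc e) c * eval W c        ≈⟨ *-congʳ (eval-* (X- c) ((X- c) ^P e) c) ⟩
        (eval (X- c) c * _) * eval W c             ≈⟨ *-congʳ (*-congʳ (eval-X-b c)) ⟩
        (0# * _) * eval W c                        ≈⟨ *-congʳ (zeroˡ _) ⟩
        0# * eval W c                              ≈⟨ zeroˡ _ ⟩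
        0#                                         ∎)
        where
        nz : ¬ (eval (X- b) c ≈ 0#)
        nz e0 = ne (sym (x∙y⁻¹≈ε⇒x≈y c b (trans (sym (eval-X- b c)) e0)))
          where open import Algebra.Properties.Group +-group using (x∙y⁻¹≈ε⇒x≈y)
      -- so Q = (x - c) Q', and cancelling x - c leaves (x - c)^e ∣ (x - b) Q'
      fQ = factorThm c Q evQ
      Q' = proj₁ fQ
      hQ' : ((X- c) *P Q') ≋ Q
      hQ' = proj₂ fQ
      eq1 : ((X- c) *P (((X- c) ^P e) *P W)) ≋ ((X- c) *P ((X- b) *P Q'))
      eq1 = ≋-trans (≋-sym (*P-assoc (X- c) ((X- c) ^P e) W)) (≋-trans w (≋-trans (*P-congʳ (X- b) (≋-sym hQ'))
              (≋-trans (≋-sym (*P-assoc (X- b) (X- c) Q')) (≋-trans (*P-congˡ Q' (*P-comm (X- b) (X- c))) (*P-assoc (X- c) (X- b) Q')))))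
      ih : ((X- c) ^P e) ∣≋ Q'
      ih = coprime e b c {Q'} ne (W , cancelXb c (((X- c) ^P e) *P W) ((X- b) *P Q') eq1)

    module Roots (d : ℕ) (b : Fin d → Carrier) (binj : ∀ i j → b i ≈ b j → i ≡ j) where
      Pr : (Fin d → ℕ) → Poly
      Pr e = prodFinP d (λ i → (X- b i) ^P e i)

      Multiplicities : Poly → (Fin d → ℕ) → Set (c ⊔ ℓ)
      Multiplicities H e = (∀ j → ((X- b j) ^P e j) ∣≋ H) × (∀ j → ¬ (((X- b j) ^P suc (e j)) ∣≋ H))

      upd : (Fin d → ℕ) → Fin d → ℕ → Fin d → ℕ
      upd e i k j with j ≟F i
      ... | yes _ = k
      ... | no _ = e j

      upd-on : ∀ e i k → upd e i k i ≡ k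
      upd-on e i k with i ≟F i
      ... | yes _ = ≡-refl
      ... | no ne = ⊥-elim (ne ≡-refl)

      upd-off : ∀ e i k j → j ≢ i → upd e i k j ≡ e j
      upd-off e i k j ne with j ≟F i
      ... | yes eq = ⊥-elim (ne eq)
      ... | no _ = ≡-refl

      quotient-multiplicities : ∀ {H Q} e i k → ((X- b i) *P Q) ≋ H → e i ≡ suc k →
        Multiplicities H e → Multiplicities Q (upd e i k)
      quotient-multiplicities {H} {Q} e i k XQ≋H eᵢ≡k+1 (dv , ndv) =
        (λ j → divides j (j ≟F i)) , (λ j → notDivides j (j ≟F i))
        where
        Xb = X- b i
        divides : ∀ j → Dec (j ≡ i) → ((X- b j) ^P upd e i k j) ∣≋ Q
        divides .i (yes ≡-refl) = pow-subst Xb (≡-sym (upd-on e i k))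
            (proj₁ w , cancelXb (b i) _ _ (≋-trans (≋-sym (*P-assoc Xb (Xb ^P k) (proj₁ w))) (≋-trans (proj₂ w) (≋-sym XQ≋H))))
          where
          w : (Xb ^P suc k) ∣≋ H
          w = pow-subst Xb eᵢ≡k+1 (dv i)
        divides j (no j≢i) = pow-subst (X- b j) (≡-sym (upd-off e i k j j≢i))
            (coprime (e j) (b i) (b j) {Q} (λ x → j≢i (≡-sym (binj i j x))) (∣-cong {(X- b j) ^P e j} (≋-sym XQ≋H) (dv j)))
        notDivides : ∀ j → Dec (j ≡ i) → ¬ (((X- b j) ^P suc (upd e i k j)) ∣≋ Q)
        notDivides .i (yes ≡-refl) dj = ndv i (pow-subst Xb (cong suc (≡-sym eᵢ≡k+1))
            (proj₁ w , ≋-trans (*P-assoc Xb (Xb ^P suc k) (proj₁ w)) (≋-trans (*P-congʳ Xb (proj₂ w)) XQ≋H)))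
          where
          w : (Xb ^P suc k) ∣≋ Q
          w = pow-subst Xb (cong suc (upd-on e i k)) dj
        notDivides j (no j≢i) dj = ndv j (∣-cong {(X- b j) ^P suc (e j)} XQ≋H
            (∣-*ˡ {(X- b j) ^P suc (e j)} {Q} Xb (pow-subst (X- b j) (cong suc (upd-off e i k j j≢i)) dj)))

      -- induction on the degree: a root z of H is some bᵢ, whose multiplicity is
      -- positive; divide by x - bᵢ and continue with the quotient
      fact : ∀ n H (e : Fin d → ℕ) → HasDegree H n → (∀ z → eval H z ≈ 0# → Σ (Fin d) λ i → z ≈ b i) →
        Multiplicities H e → H ≋ scale (coeff H n) (Pr e)
      fact zero H e hd roots (dv , _) = ≋-trans H1 (≋-sym (≋-trans (scale-cong refl (prod-ones d _ (λ i → ≋-reflexive (cong ((X- b i) ^P_) (e0 i))))) (cons-cong (*-identityʳ _) ≋-refl)))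
        where
        c0 = coeff H 0
        H1 : H ≋ (c0 ∷ [])
        H1 = mk λ { zero → refl ; (suc k) → proj₂ hd (suc k) (s≤s z≤n) }
        -- a constant c0 ≠ 0 has no roots
        e0 : ∀ i → e i ≡ 0
        e0 i with e i | dv i
        ... | zero | _ = ≡-refl
        ... | suc k | dvi = ⊥-elim (proj₁ hd (trans (sym (trans (eval-cong (b i) H1) (trans (+-congˡ (zeroʳ _)) (+-identityʳ _)))) (divEval (b i) H (pow-div (b i) k dvi))))
      fact (suc n) H e hd roots mult = peel (e i) ≡-refl
        where
        root = alg H (suc n) hd (s≤s z≤n)
        i = proj₁ (roots (proj₁ root) (proj₂ root))
        Hbᵢ≈0 : eval H (b i) ≈ 0#
        Hbᵢ≈0 = trans (eval-congʳ H (sym (proj₂ (roots (proj₁ root) (proj₂ root))))) (proj₂ root)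
        Xb = X- b i
        Q = proj₁ (factorThm (b i) H Hbᵢ≈0)
        XQ≋H : (Xb *P Q) ≋ H
        XQ≋H = proj₂ (factorThm (b i) H Hbᵢ≈0)
        degQ = linear-quotient (b i) XQ≋H hd
        rootsQ : ∀ z → eval Q z ≈ 0# → Σ (Fin d) λ j → z ≈ b j
        rootsQ z Qz≈0 = roots z (trans (sym (eval-cong z XQ≋H)) (trans (eval-* Xb Q z) (trans (*-congˡ Qz≈0) (zeroʳ _))))
        peel : ∀ m → e i ≡ m → H ≋ scale (coeff H (suc n)) (Pr e)
        peel zero eᵢ≡0 = ⊥-elim (proj₂ mult i (pow-subst Xb (≡-sym (cong suc eᵢ≡0)) (Q , ≋-trans (*P-congˡ Q (*P-idʳ Xb)) XQ≋H)))
        peel (suc k) eᵢ≡k+1 = PR.begin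
            H                                        PR.≈⟨ ≋-sym XQ≋H ⟩
            Xb *P Q                                  PR.≈⟨ *P-congʳ Xb ih ⟩
            Xb *P scale (coeff Q n) (Pr e')          PR.≈⟨ scale-*ʳ _ Xb _ ⟩
            scale (coeff Q n) (Xb *P Pr e')          PR.≈⟨ scale-cong (proj₂ degQ) (≋-sym (prod-update d (λ j → X- b j) e e' i
                                                            (≡-trans eᵢ≡k+1 (cong suc (≡-sym (upd-on e i k)))) (λ j ne → ≡-sym (upd-off e i k j ne)))) ⟩
            scale (coeff H (suc n)) (Pr e)           PR.∎
          where
          e' = upd e i k
          ih : Q ≋ scale (coeff Q n) (Pr e')
          ih = fact n Q e' (proj₁ degQ) rootsQ (quotient-multiplicities e i k XQ≋H eᵢ≡k+1 mult)

    factorisation : ∀ {P n d b μ} → HasDegree P n → RootsWithMultiplicities P d b μ →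
      P ≋ scale (coeff P n) (prodFinP d (λ i → (X- b i) ^P μ i))
    factorisation {P} {n} {d} {b} {μ} hd (distinct , _ , allRoots , mult) =
      Roots.fact d b distinct n P μ hd allRoots
        ((λ i → fromDiv {(X- b i) ^P μ i} {P} (proj₁ (mult i))) ,
         (λ i div → proj₂ (mult i) (toDiv {(X- b i) ^P suc (μ i)} {P} div)))

module Transport where

  open PolynomialArithmetic
  open PolynomialRings
  open RingHomomorphisms
  open ShiftsAndRows
  open LinearFactors
  open Factorisation
  open import Algebra.Bundles using (CommutativeRing)
  open import Algebra.Bundles.Raw using (RawRing)
  open import Data.Nat using (ℕ; zero; suc) renaming (_+_ to _+ℕ_)
  import Data.Nat.Properties as ℕP
  open import Data.Fin using (Fin; zero; suc)
  open import Data.List using ([]; _∷_; map)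
  open import Data.Product using (_,_)
  open import Data.Sum using (inj₁; inj₂)
  open import Relation.Binary.Definitions using (tri<; tri≈; tri>)
  open import Data.Empty using (⊥-elim)
  open import Relation.Binary.PropositionalEquality as Eq using (_≡_; cong) renaming (refl to ≡-refl; sym to ≡-sym; trans to ≡-trans)
  open import Function using (_∘_)

  mapIter-constI : ∀ {a ℓa b ℓb} {RA : RawRing a ℓa} {RB : RawRing b ℓb} n (h : RawRing.Carrier RA → RawRing.Carrier RB) x →
    mapIter {RA = RA} {RB = RB} n h (constI RA n x) ≡ constI RB n (h x)
  mapIter-constI zero h x = ≡-refl
  mapIter-constI (suc n) h x = cong (_∷ []) (mapIter-constI n h x)

  module MapLaws {a ℓa b ℓb} {R : CommutativeRing a ℓa} {S : CommutativeRing b ℓb} {h} (H : IsHom R S h) where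
    private
      module R = LinearFactorLaws R
      module S = LinearFactorLaws S

    map-pow : ∀ v e → map h (v R.^P e) S.≋ ((map h v) S.^P e)
    map-pow v zero = S.cons-cong (h-1 H) S.≋-refl
    map-pow v (suc e) = S.≋-trans (map-* H v (v R.^P e)) (S.*P-congʳ (map h v) (map-pow v e))

    map-prod : ∀ d (v : Fin d → R.Poly) → map h (R.prodFinP d v) S.≋ S.prodFinP d (map h ∘ v)
    map-prod zero v = S.cons-cong (h-1 H) S.≋-refl
    map-prod (suc d) v = S.≋-trans (map-* H (v zero) _) (S.*P-congʳ (map h (v zero)) (map-prod d (v ∘ suc)))

    map-sum : ∀ k (v : Fin k → R.Poly) → map h (R.sumFinP k v) S.≋ S.sumFinP k (map h ∘ v)
    map-sum zero v = S.≋-refl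
    map-sum (suc k) v = S.≋-trans (map-+ H (v zero) _) (S.+P-cong (S.≋-refl {map h (v zero)}) (map-sum k (v ∘ suc)))

    map-Xm : ∀ x → map h (R.X- x) S.≋ (S.X- (h x))
    map-Xm x = S.cons-cong (h-neg H x) (S.cons-cong (h-1 H) S.≋-refl)

    ∣-map : ∀ {G P} → G R.∣≋ P → map h G S.∣≋ map h P
    ∣-map {G} (W , w) = map h W , S.≋-trans (S.≋-sym (map-* H G W)) (map-cong≋ H w)

    deg-map : ∀ {p n} → R.Deg≤ p n → S.Deg≤ (map h p) n
    deg-map {p} d k lt = S.trans (coeff-map H p k) (S.trans (h-cong H (d k lt)) (h-0 H))

    map-factorisation : ∀ x d (b : Fin d → R.Carrier) (μ : Fin d → ℕ) →
      map h (R.scale x (R.prodFinP d (λ i → (R.X- b i) R.^P μ i))) S.≋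
      S.scale (h x) (S.prodFinP d (λ i → (S.X- h (b i)) S.^P μ i))
    map-factorisation x d b μ =
      S.≋-trans (map-scale H x _) (S.scale-cong S.refl (S.≋-trans (map-prod d _) (Products.prod-cong S d λ i →
        S.≋-trans (map-pow (R.X- b i) (μ i)) (Products.pow-cong S (μ i) (map-Xm (b i))))))

    degree-map : (∀ {x} → h x S.≈ S.0# → x R.≈ R.0#) → ∀ {p n} → R.HasDegree p n → S.HasDegree (map h p) n
    degree-map reflects0 {p} {n} (top≉0 , above) =
      (λ e → top≉0 (reflects0 (S.trans (S.sym (coeff-map H p n)) e))) , deg-map {p} above

    unit-map : ∀ {x} → R.Unit x → S.Unit (h x)
    unit-map (y , xy≈1) = h y , S.trans (S.sym (h-* H _ _)) (S.trans (h-cong H xy≈1) (h-1 H))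

    -- Let deg P ≤ δ and let ℓ be the leading coefficient of P.  If the image of P is
    -- w · M where M has an invertible coefficient u at x^δ, then h ℓ = w · u.
    -- (Either P has degree exactly δ, or the coefficient at δ vanishes, forcing w = 0.)
    leadingCoeff-map : ∀ {P ℓ δ M w} → R.Deg≤ P δ → R.IsLeadingCoeff ℓ P → S.Unit (S.coeff M δ) →
      map h P S.≋ S.scale w M → h ℓ S.≈ w S.* S.coeff M δ
    leadingCoeff-map {P} {ℓ} {δ} {M} {w} degP lc u PM = fromLeading lc
      where
      image-coeff : ∀ k → h (R.coeff P k) S.≈ w S.* S.coeff M k
      image-coeff k = S.trans (S.sym (coeff-map H P k)) (S.trans (S.at PM k) (S.coeff-scale w M k))
      vanishing : R.coeff P δ R.≈ R.0# → ∀ k → h (R.coeff P k) S.≈ w S.* S.coeff M δ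
      vanishing Pδ≈0 k = S.trans (image-coeff k) (S.trans (S.*-congʳ w≈0) (S.trans (S.zeroˡ _)
                           (S.sym (S.trans (S.*-congʳ w≈0) (S.zeroˡ _)))))
        where
        w≈0 : w S.≈ S.0#
        w≈0 = S.unit-cancel u (S.trans (S.*-comm _ _)
                (S.trans (S.sym (image-coeff δ)) (S.trans (h-cong H Pδ≈0) (h-0 H))))
      fromLeading : R.IsLeadingCoeff ℓ P → h ℓ S.≈ w S.* S.coeff M δ
      fromLeading (inj₂ (P≈0 , ℓ≈0)) = S.trans (h-cong H (R.trans ℓ≈0 (R.sym Pδ≈0))) (vanishing Pδ≈0 δ)
        where
        Pδ≈0 : R.coeff P δ R.≈ R.0#
        Pδ≈0 = R.at (R.≈P→≋ P≈0) δ
      fromLeading (inj₁ (n , (top≉0 , above) , ℓ≈top)) with ℕP.<-cmp n δ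
      ... | tri< n<δ _ _ = S.trans (h-cong H ℓ≈top) (vanishing (above δ n<δ) n)
      ... | tri≈ _ ≡-refl _ = S.trans (h-cong H ℓ≈top) (image-coeff δ)
      ... | tri> _ _ δ<n = ⊥-elim (top≉0 (degP n δ<n))

module GenericPolynomials where

  open PolynomialArithmetic
  open PolynomialRings
  open RingHomomorphisms
  open Determinants
  open ShiftsAndRows
  open BorderedDeterminant
  open SubresultantDivisibility
  open SubresultantImage
  open LinearFactors
  open Factorisation
  open Transport
  open import Level using (_⊔_)
  open import Algebra.Bundles using (CommutativeRing)
  open import Algebra.Bundles.Raw using (RawRing)
  open import Data.Nat using (ℕ; zero; suc; _∸_) renaming (_+_ to _+ℕ_)
  open import Data.Nat using (_≤_)
  open import Data.Fin using (Fin; zero; suc)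
  open import Data.List using (List; map)
  open import Data.List.Properties using (map-∘; map-cong)
  open import Data.Product using (_×_; _,_)
  open import Data.Sum using (inj₁; inj₂)
  open import Relation.Binary.PropositionalEquality as Eq using (_≡_) renaming (refl to ≡-refl; sym to ≡-sym; trans to ≡-trans)

  module FDivisibility {a ℓa c ℓc} (A : CommutativeRing a ℓa) (B : CommutativeRing c ℓc) {h} (hH : IsHom A B h) where
    private
      RA = CommutativeRing.rawRing A
      RB = CommutativeRing.rawRing B

    liftMap : ∀ n xs → map (mapIter {RA = RA} {RB = RB} n h) (map (constI RA n) xs) ≡ map (constI RB n) (map h xs)
    liftMap n xs = ≡-trans (≡-sym (map-∘ xs)) (≡-trans (map-cong (mapIter-constI n h) xs) (map-∘ xs))

    F₁-divisible : ∀ m (f : Fin m → List (CommutativeRing.Carrier A)) → 1 ≤ m →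
      (Hp : List (RawRing.Carrier (iterPoly (m ∸ 2) RB))) →
      (∀ i → Divisibility._∣≋_ (iterCR (m ∸ 2) B) Hp (map (constI RB (m ∸ 2)) (map h (f i)))) →
      Divisibility._∣≋_ (iterCR (m ∸ 2) B) Hp (map (mapIter {RA = RA} {RB = RB} (m ∸ 2) h) (F₁ RA m f))
    F₁-divisible (suc m') f _ Hp dv = Eq.subst (Divisibility._∣≋_ (iterCR (suc m' ∸ 2) B) Hp) (≡-sym (liftMap (suc m' ∸ 2) (f zero))) (dv zero)

    F₂-divisible : ∀ m (f : Fin m → List (CommutativeRing.Carrier A)) →
      (Hp : List (RawRing.Carrier (iterPoly (m ∸ 2) RB))) →
      (∀ i → Divisibility._∣≋_ (iterCR (m ∸ 2) B) Hp (map (constI RB (m ∸ 2)) (map h (f i)))) →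
      Divisibility._∣≋_ (iterCR (m ∸ 2) B) Hp (map (mapIter {RA = RA} {RB = RB} (m ∸ 2) h) (F₂ RA m f))
    F₂-divisible zero f Hp dv = Divisibility.∣-[] (iterCR 0 B) Hp
    F₂-divisible (suc zero) f Hp dv = Divisibility.∣-[] (iterCR 0 B) Hp
    F₂-divisible (suc (suc k)) f Hp dv =
      ∣-cong {Hp} (≋-sym (≋-trans (map-+ φH (liftX RA k (f (suc zero))) _) (+P-cong (≋-refl {map φ (liftX RA k (f (suc zero)))}) (MapLaws.map-sum φH k _))))
        (∣-+ {Hp} (Eq.subst (Hp ∣≋_) (≡-sym (liftMap k (f (suc zero)))) (dv (suc zero)))
          (∣-sum {Hp} k _ λ j →
            ∣-cong {Hp} (≋-sym (map-* φH (PolyOps.constP (iterPoly k RA) (var RA k j)) (liftX RA k (f (suc (suc j))))))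
              (∣-*ˡ {Hp} (map φ (PolyOps.constP (iterPoly k RA) (var RA k j))) (Eq.subst (Hp ∣≋_) (≡-sym (liftMap k (f (suc (suc j))))) (dv (suc (suc j)))))))
      where
      open Divisibility (iterCR k B)
      φ = mapIter {RA = RA} {RB = RB} k h
      φH = iterHom hH k

  module CommonDivisors {a ℓa b ℓb} {R : CommutativeRing a ℓa} {S : CommutativeRing b ℓb}
                           {φ} (φH : IsHom R S φ) where
    private
      module R = LinearFactorLaws R
      module S = LinearFactorLaws S

    DividesImage : S.Poly → R.Poly → ℕ → Set (b ⊔ ℓb ⊔ ℓa)
    DividesImage H T i = (H S.∣≋ map φ T) × R.Deg≤ T i

    DividesImage-resp : ∀ {H T U i} → T R.≈P U → DividesImage H U i → DividesImage H T i
    DividesImage-resp {H} {T} {U} T≈U (H∣U , degU) =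
      S.∣-cong {H} (map-cong≋ φH (R.≋-sym (R.≈P→≋ T≈U))) H∣U ,
      λ k lt → R.trans (R.at (R.≈P→≋ T≈U) k) (degU k lt)

    sres-divisible : ∀ p q f g i H → 1 ≤ i → i ≤ p → i ≤ q → R.HasDegree f p → R.HasDegree g q →
      H S.∣≋ map φ f → H S.∣≋ map φ g → DividesImage H (R.sres p q f g i) i
    sres-divisible p q f g i H 1≤i i≤p i≤q (_ , degf) (_ , degg) H∣f H∣g =
      S.∣-cong {H} (S.≋-sym (SubresHom.sresHom φH p q f g i))
        (SubresDiv.sresDiv S p q (map φ f) (map φ g) i H i≤p i≤q 1≤i
          (MapLaws.deg-map φH {f} degf) (MapLaws.deg-map φH {g} degg) H∣f H∣g) ,
      SubresDiv.sresDeg R p q f g i degg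

    subres-divisible : ∀ {F G i Sᵢ H} → 1 ≤ i → H S.∣≋ map φ F → H S.∣≋ map φ G →
      R.IsSubres F G i Sᵢ → DividesImage H Sᵢ i
    subres-divisible {F} {G} {i} {_} {H} 1≤i H∣F H∣G (inj₁ (p , q , hdF , hdG , i≤p , i≤q , Sᵢ≈)) =
      DividesImage-resp {H} Sᵢ≈ (sres-divisible p q F G i H 1≤i i≤p i≤q hdF hdG H∣F H∣G)
    subres-divisible {F} {G} {i} {_} {H} 1≤i H∣F H∣G (inj₂ (inj₁ (p , hdF , _ , i≤p , Sᵢ≈))) =
      DividesImage-resp {H} Sᵢ≈ (sres-divisible p p F F i H 1≤i i≤p i≤p hdF hdF H∣F H∣F)
    subres-divisible {F} {G} {i} {_} {H} 1≤i H∣F H∣G (inj₂ (inj₂ (q , _ , hdG , i≤q , Sᵢ≈))) =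
      DividesImage-resp {H} Sᵢ≈ (sres-divisible q q G G i H 1≤i i≤q i≤q hdG hdG H∣G H∣G)

open PolynomialRings
open RingHomomorphisms
open LinearFactors
open Factorisation
open Transport
open GenericPolynomials

lemma7p6 :
  ∀ {a ℓa k ℓk c ℓc}
  (A : CommutativeRing a ℓa) (K : CommutativeRing k ℓk) (K̄ : CommutativeRing c ℓc) →
  let RA = CommutativeRing.rawRing A
      RK = CommutativeRing.rawRing K
      RK̄ = CommutativeRing.rawRing K̄
  in
  IsIntegralDomain A → IsField K → IsField K̄ → PolyOps.IsAlgClosed RK̄ →
  -- A ⊆ K ⊆ K̄ via injective ring homomorphisms ι and κ
  (ι : CommutativeRing.Carrier A → CommutativeRing.Carrier K) →
  RingMorphisms.IsRingMonomorphism RA RK ι →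
  (κ : CommutativeRing.Carrier K → CommutativeRing.Carrier K̄) →
  RingMorphisms.IsRingMonomorphism RK RK̄ κ →
  -- f₁, …, f_m ∈ A[x], m ≥ 1
  (m : ℕ) → 1 ≤ m → (f : Fin m → List (CommutativeRing.Carrier A)) →
  -- G = gcd_K(f₁, …, f_m) of degree δ ≥ 1
  (G : List (CommutativeRing.Carrier K)) →
  PolyOps.IsGcdOf RK G (λ i → map ι (f i)) →
  (δ : ℕ) → PolyOps.HasDegree RK G δ → 1 ≤ δ →
  -- b₁, …, b_d the distinct roots of G in K̄, with multiplicities μ₁, …, μ_d
  (d : ℕ) (b : Fin d → CommutativeRing.Carrier K̄) (μ : Fin d → ℕ) →
  PolyOps.RootsWithMultiplicities RK̄ (map κ G) d b μ →
  -- S = S_δ(F₁, F₂) over A[y₃, …, y_m], with leading coefficient ℓ (in x)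
  (S : List (RawRing.Carrier (iterPoly (m ∸ 2) RA))) →
  PolyOps.IsSubres (iterPoly (m ∸ 2) RA) (F₁ RA m f) (F₂ RA m f) δ S →
  (ℓ : RawRing.Carrier (iterPoly (m ∸ 2) RA)) →
  PolyOps.IsLeadingCoeff (iterPoly (m ∸ 2) RA) ℓ S →
  -- S_δ(F₁, F₂) = ℓ ∏ (x - b_i)^{μ_i}   in K̄[y₃, …, y_m][x]
  PolyOps._≈P_ (iterPoly (m ∸ 2) RK̄)
    (map (mapIter {RA = RA} {RB = RK̄} (m ∸ 2) (λ z → κ (ι z))) S)
    (PolyOps.scale (iterPoly (m ∸ 2) RK̄)
      (mapIter {RA = RA} {RB = RK̄} (m ∸ 2) (λ z → κ (ι z)) ℓ)
      (PolyOps.prodFinP (iterPoly (m ∸ 2) RK̄) d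
        (λ i → PolyOps._^P_ (iterPoly (m ∸ 2) RK̄)
                 (PolyOps.X-_ (iterPoly (m ∸ 2) RK̄) (constI RK̄ (m ∸ 2) (b i)))
                 (μ i))))
lemma7p6 A K K̄ _ _ fieldK̄ closed ι ιmono κ κmono m 1≤m f G gcd δ degG 1≤δ d b μ roots S subres ℓ lc =
  K̄y.≋→≈P (K̄y.PR.begin
    map φ S                         K̄y.PR.≈⟨ proj₂ S≋wH ⟩
    K̄y.scale w H                    K̄y.PR.≈⟨ K̄y.scale-cong K̄y.refl H≋cP ⟩
    K̄y.scale w (K̄y.scale (cI c) P)  K̄y.PR.≈⟨ K̄y.scale-scale w (cI c) P ⟩
    K̄y.scale (w K̄y.* cI c) P        K̄y.PR.≈⟨ K̄y.scale-cong (K̄y.sym φℓ≈wc) K̄y.≋-refl ⟩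
    K̄y.scale (φ ℓ) P                K̄y.PR.∎)
  where
  n : ℕ
  n = m ∸ 2
  module K̄ = ClosedField K̄ fieldK̄ closed
  module K̄y = Products (iterCR n K̄)
  open CommonDivisors

  ιH : IsHom A K ι
  ιH = fromRingHom A K (RingMorphisms.IsRingMonomorphism.isRingHomomorphism ιmono)
  κH : IsHom K K̄ κ
  κH = fromRingHom K K̄ (RingMorphisms.IsRingMonomorphism.isRingHomomorphism κmono)

  φ : CommutativeRing.Carrier (iterCR n A) → K̄y.Carrier
  φ = mapIter {RA = CommutativeRing.rawRing A} {RB = CommutativeRing.rawRing K̄} n (λ z → κ (ι z))
  φH : IsHom (iterCR n A) (iterCR n K̄) φ
  φH = iterHom (compHom ιH κH) n
  cI : K̄.Carrier → K̄y.Carrier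
  cI = constI (CommutativeRing.rawRing K̄) n
  cIH : IsHom K̄ (iterCR n K̄) cI
  cIH = constIHom K̄ n

  Ḡ : K̄.Poly
  Ḡ = map κ G
  degḠ : K̄.HasDegree Ḡ δ
  degḠ = MapLaws.degree-map κH
           (λ e → RingMorphisms.IsRingMonomorphism.injective κmono (K̄.trans e (K̄.sym (h-0 κH)))) {G} degG
  c : K̄.Carrier
  c = K̄.coeff Ḡ δ
  P : K̄y.Poly
  P = K̄y.prodFinP d (λ i → (K̄y.X- cI (b i)) K̄y.^P μ i)
  H : K̄y.Poly
  H = map cI Ḡ
  H≋cP : H K̄y.≋ K̄y.scale (cI c) P
  H≋cP = K̄y.≋-trans (map-cong≋ cIH (K̄.factorisation {Ḡ} {δ} {d} {b} {μ} degḠ roots))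
                     (MapLaws.map-factorisation cIH c d b μ)
  Hδ≈cIc : K̄y.coeff H δ K̄y.≈ cI c
  Hδ≈cIc = coeff-map cIH Ḡ δ
  unitH : K̄y.Unit (K̄y.coeff H δ)
  unitH = K̄y.Unit-resp (K̄y.sym Hδ≈cIc) (MapLaws.unit-map cIH (proj₂ fieldK̄ c (proj₁ degḠ)))

  H∣fᵢ : ∀ i → H K̄y.∣≋ map cI (map (λ z → κ (ι z)) (f i))
  H∣fᵢ i = Eq.subst (λ X → H K̄y.∣≋ map cI X) (Eq.sym (map-∘ (f i)))
             (MapLaws.∣-map cIH {Ḡ} (MapLaws.∣-map κH {G}
               (LinearFactorLaws.fromDiv K {G} {map ι (f i)} (proj₁ gcd i))))
  H∣S : DividesImage φH H S δ
  H∣S = subres-divisible φH {H = H} 1≤δ (FDivisibility.F₁-divisible A K̄ (compHom ιH κH) m f 1≤m H H∣fᵢ)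
                                        (FDivisibility.F₂-divisible A K̄ (compHom ιH κH) m f H H∣fᵢ) subres

  S≋wH : Σ K̄y.Carrier λ w → map φ S K̄y.≋ K̄y.scale w H
  S≋wH = K̄y.constantMultiple H (map φ S) δ (MapLaws.deg-map cIH {Ḡ} (proj₂ degḠ)) unitH
           (MapLaws.deg-map φH {S} (proj₂ H∣S)) (proj₁ H∣S)
  w : K̄y.Carrier
  w = proj₁ S≋wH
  φℓ≈wc : φ ℓ K̄y.≈ w K̄y.* cI c
  φℓ≈wc = K̄y.trans (MapLaws.leadingCoeff-map φH (proj₂ H∣S) lc unitH (proj₂ S≋wH)) (K̄y.*-congˡ Hδ≈cIc)
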